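{- Let $r$ be a power of $2$. For each odd integer $n>0$ let $A_n\in t\,\mathbb{Z}/2[t^2]$, and suppose that for all odd $n>0$ \[ A_{n+16r}=t^{16r}A_n+t^{4r}A_{n+4r}+t^{2r}A_{n+2r}. \] Say that $A_n$ satisfies condition $(1\alpha)$ if, writing $t^n=[a,b]$: when $a>0$, $A_n=[a-1,b]+$ a sum of monomials preceding $[a-1,b]$; when $a=0$, $A_n$ is a sum of monomials each equal to or preceding $[0,b-1]$. If $A_n$ satisfies $(1\alpha)$ for every odd $n<16r^2$, then $A_n$ satisfies $(1\alpha)$ for every odd $n>0$.
   Context: $\mathbb{N}=\{0,1,2,\dots\}$. Let $g:\mathbb{N}\to\mathbb{N}$ be defined by $g(0)=0$, $g(2n)=4g(n)$, $g(2n+1)=g(2n)+1$. For $a,b\in\mathbb{N}$, $[a,b]$ denotes the monomial $t^{1+2g(a)+4g(b)}\in\mathbb{Z}/2[t]$; $(a,b)\mapsto[a,b]$ is a bijection from $\mathbb{N}\times\mathbb{N}$ onto the monomials $t^k$, $k$ odd and positive. Say $[c,d]$ precedes (is earlier than) $[a,b]$ if $c+d<a+b$, or $c+d=a+b$ and $d<b$. "A sum of monomials" with some property means a finite sum (possibly empty, i.e. $0$) of distinct monomials with that property. When $b=0$, no monomial is "equal to or preceding $[0,b-1]$", so the condition then means $A_n=0$. -}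

module Defs where

open import Data.Nat using (ℕ; zero; suc; _+_; _*_; _∸_; _^_; _≤_; _<_)
open import Data.Nat.DivMod using (_/_; _%_)
open import Data.Bool using (Bool; true; false; if_then_else_; _xor_)
open import Data.Nat using (_<ᵇ_)
open import Data.Product using (Σ; ∃; ∃-syntax; _×_; _,_)
open import Data.Sum using (_⊎_)
open import Data.Empty using (⊥)
open import Relation.Binary.PropositionalEquality using (_≡_)

Odd : ℕ → Set
Odd n = ∃[ m ] n ≡ suc (2 * m)

-- g(0)=0, g(2n)=4g(n), g(2n+1)=4g(n)+1, computed with fuel (n halvings suffice)
gAux : ℕ → ℕ → ℕ
gAux zero    n = 0
gAux (suc f) n = 4 * gAux f (n / 2) + n % 2

g : ℕ → ℕ
g n = gAux n n

-- [a,b] is the monomial t^(1 + 2 g(a) + 4 g(b)); we record its exponent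
br : ℕ → ℕ → ℕ
br a b = 1 + 2 * g a + 4 * g b

Precedes : ℕ → ℕ → ℕ → ℕ → Set
Precedes c d a b = (c + d < a + b) ⊎ ((c + d ≡ a + b) × (d < b))

-- polynomials over Z/2: coefficient functions (finite support assumed separately)
Poly : Set
Poly = ℕ → Bool

FiniteSupport : Poly → Set
FiniteSupport p = ∃[ N ] ∀ k → N ≤ k → p k ≡ false

OddPoly : Poly → Set
OddPoly p = ∀ k → p k ≡ true → Odd k

shift : ℕ → Poly → Poly
shift m p k = if k <ᵇ m then false else p (k ∸ m)

_⊕_ : Poly → Poly → Poly
(p ⊕ q) k = p k xor q k

infixl 6 _⊕_

EqOrPrecZeroPred : ℕ → ℕ → Set
EqOrPrecZeroPred k zero = ⊥
EqOrPrecZeroPred k (suc b') =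
  ∃[ c ] ∃[ d ] (k ≡ br c d × (((c ≡ 0) × (d ≡ b')) ⊎ Precedes c d 0 b'))

Cond1α : ℕ → Poly → Set
Cond1α n p = ∀ a b → n ≡ br a b → Case a b
  where
  Case : ℕ → ℕ → Set
  Case zero b = ∀ k → p k ≡ true → EqOrPrecZeroPred k b
  Case (suc a') b =
    (p (br a' b) ≡ true) ×
    (∀ k → p k ≡ true → k ≡ br a' b ⊎ (∃[ c ] ∃[ d ] (k ≡ br c d × Precedes c d a' b)))

-- Write t^(1+2e) = [aOf e , bOf e]: the base-4 digits of e = g a + 2 g b are split into the binary
-- digits of a and b. [c,d] precedes [a,b] iff key (c,d) = (c + d , d) is lexicographically smaller,
-- so (1α) for A_(1+2e) says that every monomial t^(1+2x) of A_(1+2e) has key x + (1,0) ≤ key e,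
-- the bound being attained by the lead monomial when aOf e > 0. Since base-4 carries only lower it,
-- the key is subadditive. Over Z/2 the recurrence for r implies the one for 2r, hence for every
-- power of two R ≥ r. For odd n = 1 + 2m ≥ 16r², choose R with 8R ≤ m < 16R and write m = 8R + e';
-- the recurrence at step R expresses A_n by shifts of A at 1 + 2e', 1 + 2(e' + 2R), 1 + 2(e' + R),
-- and subadditivity bounds the keys of all three terms. At the lead monomial the third term is
-- silent because key (8R) > 2 key R. Depending on whether 8R is a pure b-digit (R = 4^i) or a pure
-- a-digit (R = 2·4^i), exactly one of the first two terms contributes; the other one would force
-- aOf e' > 0 where it is 0, or two jumps g a - g (a - 1) of g to differ by 4R, which is impossible.
module Submission where

open import Defs
open import Data.Nat
open import Data.Nat.DivMod
open import Data.Nat.Induction using (<-rec)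
open import Data.Nat.Properties
open import Data.Nat.Tactic.RingSolver using (solve-∀)
open import Data.Product using (∃; ∃-syntax; _×_; _,_; proj₁; proj₂)
open import Data.Product.Relation.Binary.Lex.Strict using (×-Lex; ×-transitive; ×-antisymmetric; ×-decidable)
open import Data.Product.Relation.Binary.Pointwise.NonDependent using (≡×≡⇒≡)
open import Data.Sum using (_⊎_; inj₁; inj₂)
open import Data.Bool using (Bool; true; false; _xor_)
open import Data.Bool.Properties using (¬-not)
open import Data.Bool.Solver using (module xor-∧-Solver)
open import Data.Empty using (⊥; ⊥-elim)
open import Relation.Binary.Bundles using (Preorder)
import Relation.Binary.Reasoning.Preorder as PreorderReasoning
open import Relation.Nullary using (yes; no; contradiction)
open import Relation.Nullary.Decidable using (True; toWitness)
open import Relation.Binary.PropositionalEquality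

[β+n*x]%n≡β : ∀ {n} .{{_ : NonZero n}} β x → β < n → (β + n * x) % n ≡ β
[β+n*x]%n≡β {n} β x β<n = begin
  (β + n * x) % n ≡⟨ cong (λ z → (β + z) % n) (*-comm n x) ⟩
  (β + x * n) % n ≡⟨ [m+kn]%n≡m%n β x n ⟩
  β % n           ≡⟨ m<n⇒m%n≡m β<n ⟩
  β               ∎
  where open ≡-Reasoning

[β+n*x]/n≡x : ∀ {n} .{{_ : NonZero n}} β x → β < n → (β + n * x) / n ≡ x
[β+n*x]/n≡x {n} β x β<n = begin
  (β + n * x) / n   ≡⟨ cong (λ z → (β + z) / n) (*-comm n x) ⟩
  (β + x * n) / n   ≡⟨ +-distrib-/ β (x * n) no-carry ⟩
  β / n + x * n / n ≡⟨ cong₂ _+_ (m<n⇒m/n≡0 β<n) (m*n/n≡m x n) ⟩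
  x                 ∎
  where
  open ≡-Reasoning
  no-carry : β % n + x * n % n < n
  no-carry = subst (λ z → β % n + z < n) (sym (m*n%n≡0 x n))
                   (subst (_< n) (sym (+-identityʳ _)) (m%n<n β n))

m≡m%n+n*[m/n] : ∀ m n .{{_ : NonZero n}} → m ≡ m % n + n * (m / n)
m≡m%n+n*[m/n] m n = trans (m≡m%n+[m/n]*n m n) (cong (m % n +_) (*-comm (m / n) n))

m≤1+k⇒m/n≤k : ∀ {m k} n .{{_ : NonZero n}} → 1 < n → m ≤ suc k → m / n ≤ k
m≤1+k⇒m/n≤k {m} {k} n 1<n m≤1+k =
  ≤-pred (≤-<-trans (/-monoˡ-≤ n m≤1+k) (m/n<m (suc k) n 1<n))

2*m≤1+2*n⇒m≤n : ∀ {m n} → 2 * m ≤ suc (2 * n) → m ≤ n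
2*m≤1+2*n⇒m≤n {m} {n} 2m≤1+2n =
  ≮⇒≥ λ n<m → <-irrefl refl (≤-trans (subst (_≤ 2 * m) (*-suc 2 n) (*-monoʳ-≤ 2 n<m)) 2m≤1+2n)

gAux-zero : ∀ f → gAux f 0 ≡ 0
gAux-zero zero    = refl
gAux-zero (suc f) = cong (λ z → 4 * z + 0) (gAux-zero f)

gAux-fuel : ∀ f f' n → n ≤ f → n ≤ f' → gAux f n ≡ gAux f' n
gAux-fuel f       f'       zero    _   _    = trans (gAux-zero f) (sym (gAux-zero f'))
gAux-fuel (suc f) (suc f') (suc n) n≤f n≤f' =
  cong (λ z → 4 * z + suc n % 2)
       (gAux-fuel f f' (suc n / 2) (m≤1+k⇒m/n≤k 2 (s≤s (s≤s z≤n)) n≤f) (m≤1+k⇒m/n≤k 2 (s≤s (s≤s z≤n)) n≤f'))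

g-digit : ∀ β x → β < 2 → g (β + 2 * x) ≡ β + 4 * g x
g-digit β x β<2 = begin
  gAux y y                           ≡⟨ gAux-fuel y (suc y) y ≤-refl (n≤1+n y) ⟩
  4 * gAux y (y / 2) + y % 2         ≡⟨ cong₂ (λ u v → 4 * gAux y u + v) ([β+n*x]/n≡x β x β<2) ([β+n*x]%n≡β β x β<2) ⟩
  4 * gAux y x + β                   ≡⟨ cong (λ z → 4 * z + β) (gAux-fuel y x x x≤y ≤-refl) ⟩
  4 * g x + β                        ≡⟨ +-comm (4 * g x) β ⟩
  β + 4 * g x                        ∎
  where
  open ≡-Reasoning
  y = β + 2 * x
  x≤y : x ≤ y
  x≤y = ≤-trans (m≤m+n x (x + 0)) (m≤n+m (2 * x) β)

-- Coordinates of odd exponents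

interleave : ℕ → ℕ → ℕ
interleave a b = g a + 2 * g b

br≡1+2*interleave : ∀ a b → br a b ≡ suc (2 * interleave a b)
br≡1+2*interleave a b = lemma (g a) (g b)
  where
  lemma : ∀ x y → 1 + 2 * x + 4 * y ≡ suc (2 * (x + 2 * y))
  lemma = solve-∀

interleave-digit : ∀ α β a b → α < 2 → β < 2 →
                   interleave (α + 2 * a) (β + 2 * b) ≡ (α + 2 * β) + 4 * interleave a b
interleave-digit α β a b α<2 β<2 = begin
  g (α + 2 * a) + 2 * g (β + 2 * b)     ≡⟨ cong₂ (λ u v → u + 2 * v) (g-digit α a α<2) (g-digit β b β<2) ⟩
  (α + 4 * g a) + 2 * (β + 4 * g b)     ≡⟨ regroup α β (g a) (g b) ⟩
  (α + 2 * β) + 4 * (g a + 2 * g b)     ∎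
  where
  open ≡-Reasoning
  regroup : ∀ α β x y → (α + 4 * x) + 2 * (β + 4 * y) ≡ (α + 2 * β) + 4 * (x + 2 * y)
  regroup = solve-∀

-- Applies d to every base-4 digit of e and reads the results as binary digits; fuel f ≥ e suffices.
mapDigitsF : (ℕ → ℕ) → ℕ → ℕ → ℕ
mapDigitsF d zero    e = 0
mapDigitsF d (suc f) e = d (e % 4) + 2 * mapDigitsF d f (e / 4)

mapDigits : (ℕ → ℕ) → ℕ → ℕ
mapDigits d e = mapDigitsF d e e

module _ {d : ℕ → ℕ} (d0≡0 : d 0 ≡ 0) where

  mapDigitsF-zero : ∀ f → mapDigitsF d f 0 ≡ 0
  mapDigitsF-zero zero    = refl
  mapDigitsF-zero (suc f) = cong₂ (λ u v → u + 2 * v) d0≡0 (mapDigitsF-zero f)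

  mapDigitsF-fuel : ∀ f f' e → e ≤ f → e ≤ f' → mapDigitsF d f e ≡ mapDigitsF d f' e
  mapDigitsF-fuel f       f'       zero    _   _    = trans (mapDigitsF-zero f) (sym (mapDigitsF-zero f'))
  mapDigitsF-fuel (suc f) (suc f') (suc e) e≤f e≤f' =
    cong (λ z → d (suc e % 4) + 2 * z)
         (mapDigitsF-fuel f f' (suc e / 4) (m≤1+k⇒m/n≤k 4 (s≤s (s≤s z≤n)) e≤f)
                                           (m≤1+k⇒m/n≤k 4 (s≤s (s≤s z≤n)) e≤f'))

  mapDigits-digit : ∀ r q → r < 4 → mapDigits d (r + 4 * q) ≡ d r + 2 * mapDigits d q
  mapDigits-digit r q r<4 = begin
    mapDigitsF d e e                   ≡⟨ mapDigitsF-fuel e (suc e) e ≤-refl (n≤1+n e) ⟩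
    d (e % 4) + 2 * mapDigitsF d e (e / 4)
      ≡⟨ cong₂ (λ u v → d u + 2 * mapDigitsF d e v) ([β+n*x]%n≡β r q r<4) ([β+n*x]/n≡x r q r<4) ⟩
    d r + 2 * mapDigitsF d e q         ≡⟨ cong (λ z → d r + 2 * z) (mapDigitsF-fuel e q q q≤e ≤-refl) ⟩
    d r + 2 * mapDigits d q            ∎
    where
    open ≡-Reasoning
    e = r + 4 * q
    q≤e : q ≤ e
    q≤e = ≤-trans (m≤m+n q (3 * q)) (m≤n+m (4 * q) r)

-- t ^ (1 + 2 e) = [ aOf e , bOf e ]
aOf : ℕ → ℕ
aOf = mapDigits (_% 2)

bOf : ℕ → ℕ
bOf = mapDigits (_/ 2)

aOf-digit : ∀ r q → r < 4 → aOf (r + 4 * q) ≡ r % 2 + 2 * aOf q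
aOf-digit = mapDigits-digit refl

bOf-digit : ∀ r q → r < 4 → bOf (r + 4 * q) ≡ r / 2 + 2 * bOf q
bOf-digit = mapDigits-digit refl

α+2*β<4 : ∀ {α β} → α < 2 → β < 2 → α + 2 * β < 4
α+2*β<4 (s≤s α≤1) (s≤s β≤1) = s≤s (+-mono-≤ α≤1 (*-monoʳ-≤ 2 β≤1))

interleave-aOf-bOf : ∀ e → interleave (aOf e) (bOf e) ≡ e
interleave-aOf-bOf = <-rec _ step
  where
  step : ∀ e → (∀ {e'} → e' < e → interleave (aOf e') (bOf e') ≡ e') → interleave (aOf e) (bOf e) ≡ e
  step zero    _  = refl
  step e@(suc _) ih = begin
    interleave (aOf e) (bOf e)
      ≡⟨ cong (λ z → interleave (aOf z) (bOf z)) (m≡m%n+n*[m/n] e 4) ⟩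
    interleave (aOf (r + 4 * q)) (bOf (r + 4 * q))
      ≡⟨ cong₂ interleave (aOf-digit r q r<4) (bOf-digit r q r<4) ⟩
    interleave (r % 2 + 2 * aOf q) (r / 2 + 2 * bOf q)
      ≡⟨ interleave-digit (r % 2) (r / 2) (aOf q) (bOf q) (m%n<n r 2) (m<n*o⇒m/o<n r<4) ⟩
    (r % 2 + 2 * (r / 2)) + 4 * interleave (aOf q) (bOf q)
      ≡⟨ cong₂ (λ u v → u + 4 * v) (sym (m≡m%n+n*[m/n] r 2)) (ih (m/n<m e 4 (s≤s (s≤s z≤n)))) ⟩
    r + 4 * q
      ≡⟨ sym (m≡m%n+n*[m/n] e 4) ⟩
    e ∎
    where
    open ≡-Reasoning
    r = e % 4
    q = e / 4
    r<4 : r < 4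
    r<4 = m%n<n e 4

aOf-bOf-interleave : ∀ a b → aOf (interleave a b) ≡ a × bOf (interleave a b) ≡ b
aOf-bOf-interleave a b = go (a + b) a b (m≤m+n a b) (m≤n+m b a)
  where
  go : ∀ n a b → a ≤ n → b ≤ n → aOf (interleave a b) ≡ a × bOf (interleave a b) ≡ b
  go zero    zero zero _   _   = refl , refl
  go (suc n) a    b    a≤n b≤n = aOf-ab , bOf-ab
    where
    open ≡-Reasoning
    α = a % 2
    β = b % 2
    α<2 = m%n<n a 2
    β<2 = m%n<n b 2
    X = interleave (a / 2) (b / 2)
    ih : aOf X ≡ a / 2 × bOf X ≡ b / 2
    ih = go n (a / 2) (b / 2) (m≤1+k⇒m/n≤k 2 (s≤s (s≤s z≤n)) a≤n) (m≤1+k⇒m/n≤k 2 (s≤s (s≤s z≤n)) b≤n)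
    ab≡ : interleave a b ≡ (α + 2 * β) + 4 * X
    ab≡ = trans (cong₂ interleave (m≡m%n+n*[m/n] a 2) (m≡m%n+n*[m/n] b 2))
                (interleave-digit α β (a / 2) (b / 2) α<2 β<2)
    aOf-ab : aOf (interleave a b) ≡ a
    aOf-ab = begin
      aOf (interleave a b)          ≡⟨ cong aOf ab≡ ⟩
      aOf ((α + 2 * β) + 4 * X)     ≡⟨ aOf-digit (α + 2 * β) X (α+2*β<4 α<2 β<2) ⟩
      (α + 2 * β) % 2 + 2 * aOf X   ≡⟨ cong₂ (λ u v → u + 2 * v) ([β+n*x]%n≡β α β α<2) (proj₁ ih) ⟩
      α + 2 * (a / 2)               ≡⟨ sym (m≡m%n+n*[m/n] a 2) ⟩
      a                             ∎
    bOf-ab : bOf (interleave a b) ≡ b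
    bOf-ab = begin
      bOf (interleave a b)          ≡⟨ cong bOf ab≡ ⟩
      bOf ((α + 2 * β) + 4 * X)     ≡⟨ bOf-digit (α + 2 * β) X (α+2*β<4 α<2 β<2) ⟩
      (α + 2 * β) / 2 + 2 * bOf X   ≡⟨ cong₂ (λ u v → u + 2 * v) ([β+n*x]/n≡x α β α<2) (proj₂ ih) ⟩
      β + 2 * (b / 2)               ≡⟨ sym (m≡m%n+n*[m/n] b 2) ⟩
      b                             ∎

aOf-interleave : ∀ a b → aOf (interleave a b) ≡ a
aOf-interleave a b = proj₁ (aOf-bOf-interleave a b)

bOf-interleave : ∀ a b → bOf (interleave a b) ≡ b
bOf-interleave a b = proj₂ (aOf-bOf-interleave a b)

-- The precedence key

_≤ₗₑₓ_ : ℕ × ℕ → ℕ × ℕ → Set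
_≤ₗₑₓ_ = ×-Lex _≡_ _<_ _≤_

infix 4 _≤ₗₑₓ_

≤ₗₑₓ-refl : ∀ {p} → p ≤ₗₑₓ p
≤ₗₑₓ-refl = inj₂ (refl , ≤-refl)

≤ₗₑₓ-reflexive : ∀ {p q} → p ≡ q → p ≤ₗₑₓ q
≤ₗₑₓ-reflexive refl = ≤ₗₑₓ-refl

≤ₗₑₓ-trans : ∀ {p q r} → p ≤ₗₑₓ q → q ≤ₗₑₓ r → p ≤ₗₑₓ r
≤ₗₑₓ-trans = ×-transitive {_<₂_ = _≤_} isEquivalence (resp₂ _<_) <-trans ≤-trans

≤ₗₑₓ-antisym : ∀ {p q} → p ≤ₗₑₓ q → q ≤ₗₑₓ p → p ≡ q
≤ₗₑₓ-antisym {p} {q} p≤q q≤p =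
  ≡×≡⇒≡ (×-antisymmetric {_≈₂_ = _≡_} sym <-irrefl <-asym ≤-antisym {p} {q} p≤q q≤p)

≤ₗₑₓ-by-computation : ∀ {p q} → {True (×-decidable _≟_ _<?_ _≤?_ p q)} → p ≤ₗₑₓ q
≤ₗₑₓ-by-computation {p} {q} {holds} = toWitness holds

≤ₗₑₓ-preorder : Preorder _ _ _
≤ₗₑₓ-preorder = record
  { Carrier    = ℕ × ℕ
  ; _≈_        = _≡_
  ; _≲_        = _≤ₗₑₓ_
  ; isPreorder = record { isEquivalence = isEquivalence ; reflexive = ≤ₗₑₓ-reflexive ; trans = ≤ₗₑₓ-trans }
  }

module ≤ₗₑₓ-Reasoning = PreorderReasoning ≤ₗₑₓ-preorder

infixl 6 _+ₚ_

_+ₚ_ : ℕ × ℕ → ℕ × ℕ → ℕ × ℕ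
(a , b) +ₚ (c , d) = (a + c , b + d)

twice : ℕ × ℕ → ℕ × ℕ
twice p = p +ₚ p

+ₚ-mono-≤ₗₑₓ : ∀ {p p' q q'} → p ≤ₗₑₓ p' → q ≤ₗₑₓ q' → p +ₚ q ≤ₗₑₓ p' +ₚ q'
+ₚ-mono-≤ₗₑₓ (inj₁ a<a')          (inj₁ c<c')          = inj₁ (+-mono-< a<a' c<c')
+ₚ-mono-≤ₗₑₓ (inj₁ a<a')          (inj₂ (refl , _))    = inj₁ (+-monoˡ-< _ a<a')
+ₚ-mono-≤ₗₑₓ (inj₂ (refl , _))    (inj₁ c<c')          = inj₁ (+-monoʳ-< _ c<c')
+ₚ-mono-≤ₗₑₓ (inj₂ (refl , b≤b')) (inj₂ (refl , d≤d')) = inj₂ (refl , +-mono-≤ b≤b' d≤d')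

+ₚ-monoˡ-≤ₗₑₓ : ∀ q {p p'} → p ≤ₗₑₓ p' → p +ₚ q ≤ₗₑₓ p' +ₚ q
+ₚ-monoˡ-≤ₗₑₓ q p≤p' = +ₚ-mono-≤ₗₑₓ p≤p' (≤ₗₑₓ-refl {q})

+ₚ-monoʳ-≤ₗₑₓ : ∀ p {q q'} → q ≤ₗₑₓ q' → p +ₚ q ≤ₗₑₓ p +ₚ q'
+ₚ-monoʳ-≤ₗₑₓ p q≤q' = +ₚ-mono-≤ₗₑₓ (≤ₗₑₓ-refl {p}) q≤q'

twice-mono-≤ₗₑₓ : ∀ {p q} → p ≤ₗₑₓ q → twice p ≤ₗₑₓ twice q
twice-mono-≤ₗₑₓ p≤q = +ₚ-mono-≤ₗₑₓ p≤q p≤q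

+ₚ-assoc : ∀ p q o → p +ₚ q +ₚ o ≡ p +ₚ (q +ₚ o)
+ₚ-assoc (p₁ , p₂) (q₁ , q₂) (o₁ , o₂) = cong₂ _,_ (+-assoc p₁ q₁ o₁) (+-assoc p₂ q₂ o₂)

+ₚ-swapʳ : ∀ p q o → p +ₚ q +ₚ o ≡ p +ₚ o +ₚ q
+ₚ-swapʳ (p₁ , p₂) (q₁ , q₂) (o₁ , o₂) = cong₂ _,_ (swap p₁ q₁ o₁) (swap p₂ q₂ o₂)
  where
  swap : ∀ a b c → a + b + c ≡ a + c + b
  swap = solve-∀

+ₚ-interchange : ∀ p q o u → (p +ₚ q) +ₚ (o +ₚ u) ≡ (p +ₚ o) +ₚ (q +ₚ u)
+ₚ-interchange (p₁ , p₂) (q₁ , q₂) (o₁ , o₂) (u₁ , u₂) = cong₂ _,_ (interchange p₁ q₁ o₁ u₁) (interchange p₂ q₂ o₂ u₂)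
  where
  interchange : ∀ a b c d → (a + b) + (c + d) ≡ (a + c) + (b + d)
  interchange = solve-∀

twice-+ₚ³ : ∀ p q o → twice (p +ₚ (q +ₚ o)) ≡ twice p +ₚ (twice q +ₚ twice o)
twice-+ₚ³ p q o = trans (+ₚ-interchange p (q +ₚ o) p (q +ₚ o)) (cong (twice p +ₚ_) (+ₚ-interchange q o q o))

+ₚ-cancelʳ-≡ : ∀ p p' q → p +ₚ q ≡ p' +ₚ q → p ≡ p'
+ₚ-cancelʳ-≡ (a , b) (a' , b') (c , d) eq =
  cong₂ _,_ (+-cancelʳ-≡ c a a' (cong proj₁ eq)) (+-cancelʳ-≡ d b b' (cong proj₂ eq))

+ₚ-cancelˡ-≡ : ∀ p q q' → p +ₚ q ≡ p +ₚ q' → q ≡ q'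
+ₚ-cancelˡ-≡ (a , b) (c , d) (c' , d') eq =
  cong₂ _,_ (+-cancelˡ-≡ a c c' (cong proj₁ eq)) (+-cancelˡ-≡ b d d' (cong proj₂ eq))

-- Precedes c d a b unfolds to ×-Lex _≡_ _<_ _<_ (c + d , d) (a + b , b): the precedence order
-- on [c,d] is the lexicographic order on (c + d , d).
key : ℕ → ℕ × ℕ
key e = (aOf e + bOf e , bOf e)

digitKey : ℕ → ℕ × ℕ
digitKey r = (r % 2 + r / 2 , r / 2)

key-digit : ∀ r q → r < 4 → key (r + 4 * q) ≡ digitKey r +ₚ twice (key q)
key-digit r q r<4 rewrite aOf-digit r q r<4 | bOf-digit r q r<4 =
  cong₂ _,_ (regroup (r % 2) (r / 2) (aOf q) (bOf q)) (cong (r / 2 +_) (double (bOf q)))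
  where
  regroup : ∀ α β a b → α + 2 * a + (β + 2 * b) ≡ α + β + ((a + b) + (a + b))
  regroup = solve-∀
  double : ∀ b → 2 * b ≡ b + b
  double = solve-∀

key-4* : ∀ q → key (4 * q) ≡ twice (key q)
key-4* q = key-digit 0 q (s≤s z≤n)

key-by-digits : ∀ e → key e ≡ digitKey (e % 4) +ₚ twice (key (e / 4))
key-by-digits e = trans (cong key (m≡m%n+n*[m/n] e 4)) (key-digit (e % 4) (e / 4) (m%n<n e 4))

key-interleave : ∀ a b → key (interleave a b) ≡ (a + b , b)
key-interleave a b rewrite aOf-interleave a b | bOf-interleave a b = refl

-- Adding two base-4 digits produces a carry into the next digit; this never raises the key.
carry-bound : ∀ r₁ r₂ → r₁ < 4 → r₂ < 4 →
              digitKey ((r₁ + r₂) % 4) +ₚ twice (key ((r₁ + r₂) / 4)) ≤ₗₑₓ digitKey r₁ +ₚ digitKey r₂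
carry-bound 0 0 _ _ = ≤ₗₑₓ-by-computation
carry-bound 0 1 _ _ = ≤ₗₑₓ-by-computation
carry-bound 0 2 _ _ = ≤ₗₑₓ-by-computation
carry-bound 0 3 _ _ = ≤ₗₑₓ-by-computation
carry-bound 1 0 _ _ = ≤ₗₑₓ-by-computation
carry-bound 1 1 _ _ = ≤ₗₑₓ-by-computation
carry-bound 1 2 _ _ = ≤ₗₑₓ-by-computation
carry-bound 1 3 _ _ = ≤ₗₑₓ-by-computation
carry-bound 2 0 _ _ = ≤ₗₑₓ-by-computation
carry-bound 2 1 _ _ = ≤ₗₑₓ-by-computation
carry-bound 2 2 _ _ = ≤ₗₑₓ-by-computation
carry-bound 2 3 _ _ = ≤ₗₑₓ-by-computation
carry-bound 3 0 _ _ = ≤ₗₑₓ-by-computation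
carry-bound 3 1 _ _ = ≤ₗₑₓ-by-computation
carry-bound 3 2 _ _ = ≤ₗₑₓ-by-computation
carry-bound 3 3 _ _ = ≤ₗₑₓ-by-computation
carry-bound (suc (suc (suc (suc _)))) _ (s≤s (s≤s (s≤s (s≤s ())))) _
carry-bound _ (suc (suc (suc (suc _)))) _ (s≤s (s≤s (s≤s (s≤s ()))))

key-subadditive : ∀ x y → key (x + y) ≤ₗₑₓ key x +ₚ key y
key-subadditive x y = go (x + y) x y ≤-refl
  where
  go : ∀ n x y → x + y ≤ n → key (x + y) ≤ₗₑₓ key x +ₚ key y
  go zero    zero zero _     = ≤ₗₑₓ-refl
  go (suc n) x    y    x+y≤n = chain
    where
    r₁ = x % 4
    q₁ = x / 4
    r₂ = y % 4
    q₂ = y / 4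
    r = (r₁ + r₂) % 4
    c = (r₁ + r₂) / 4
    s = c + (q₁ + q₂)
    r<4 = m%n<n (r₁ + r₂) 4
    x+y≡ : x + y ≡ r + 4 * s
    x+y≡ = begin
      x + y                          ≡⟨ cong₂ _+_ (m≡m%n+n*[m/n] x 4) (m≡m%n+n*[m/n] y 4) ⟩
      (r₁ + 4 * q₁) + (r₂ + 4 * q₂)  ≡⟨ regroup r₁ r₂ q₁ q₂ ⟩
      (r₁ + r₂) + 4 * (q₁ + q₂)      ≡⟨ cong (λ t → t + 4 * (q₁ + q₂)) (m≡m%n+n*[m/n] (r₁ + r₂) 4) ⟩
      (r + 4 * c) + 4 * (q₁ + q₂)    ≡⟨ regroup′ r c (q₁ + q₂) ⟩
      r + 4 * s                      ∎
      where
      open ≡-Reasoning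
      regroup : ∀ a b p q → (a + 4 * p) + (b + 4 * q) ≡ (a + b) + 4 * (p + q)
      regroup = solve-∀
      regroup′ : ∀ a c q → (a + 4 * c) + 4 * q ≡ a + 4 * (c + q)
      regroup′ = solve-∀
    s≤n : s ≤ n
    s≤n = subst (_≤ n) ([β+n*x]/n≡x r s r<4) (m≤1+k⇒m/n≤k 4 (s≤s (s≤s z≤n)) (subst (_≤ suc n) x+y≡ x+y≤n))
    ih : key s ≤ₗₑₓ key c +ₚ (key q₁ +ₚ key q₂)
    ih = ≤ₗₑₓ-trans (go n c (q₁ + q₂) s≤n) (+ₚ-monoʳ-≤ₗₑₓ (key c) (go n q₁ q₂ (≤-trans (m≤n+m (q₁ + q₂) c) s≤n)))
    chain : key (x + y) ≤ₗₑₓ key x +ₚ key y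
    chain = begin
      key (x + y)                                          ≡⟨ cong key x+y≡ ⟩
      key (r + 4 * s)                                      ≡⟨ key-digit r s r<4 ⟩
      digitKey r +ₚ twice (key s)                          ≲⟨ +ₚ-monoʳ-≤ₗₑₓ (digitKey r) (twice-mono-≤ₗₑₓ ih) ⟩
      digitKey r +ₚ twice (key c +ₚ (key q₁ +ₚ key q₂))
        ≡⟨ cong (digitKey r +ₚ_) (twice-+ₚ³ (key c) (key q₁) (key q₂)) ⟩
      digitKey r +ₚ (twice (key c) +ₚ (twice (key q₁) +ₚ twice (key q₂)))
        ≡⟨ sym (+ₚ-assoc (digitKey r) _ _) ⟩
      (digitKey r +ₚ twice (key c)) +ₚ (twice (key q₁) +ₚ twice (key q₂))
        ≲⟨ +ₚ-monoˡ-≤ₗₑₓ _ (carry-bound r₁ r₂ (m%n<n x 4) (m%n<n y 4)) ⟩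
      (digitKey r₁ +ₚ digitKey r₂) +ₚ (twice (key q₁) +ₚ twice (key q₂))
        ≡⟨ +ₚ-interchange (digitKey r₁) (digitKey r₂) _ _ ⟩
      (digitKey r₁ +ₚ twice (key q₁)) +ₚ (digitKey r₂ +ₚ twice (key q₂))
        ≡⟨ sym (cong₂ _+ₚ_ (key-by-digits x) (key-by-digits y)) ⟩
      key x +ₚ key y                                       ∎
      where open ≤ₗₑₓ-Reasoning

≤ₗₑₓ⇒≡⊎precedes : ∀ {c d a b} → (c + d , d) ≤ₗₑₓ (a + b , b) → (c ≡ a × d ≡ b) ⊎ Precedes c d a b
≤ₗₑₓ⇒≡⊎precedes                 (inj₁ c+d<a+b)       = inj₂ (inj₁ c+d<a+b)
≤ₗₑₓ⇒≡⊎precedes {c} {d} {a} {b} (inj₂ (c+d≡a+b , d≤b)) with m≤n⇒m<n∨m≡n d≤b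
... | inj₁ d<b  = inj₂ (inj₂ (c+d≡a+b , d<b))
... | inj₂ refl = inj₁ (+-cancelʳ-≡ d c a c+d≡a+b , refl)

≡⊎precedes⇒≤ₗₑₓ : ∀ {c d a b} → (c ≡ a × d ≡ b) ⊎ Precedes c d a b → (c + d , d) ≤ₗₑₓ (a + b , b)
≡⊎precedes⇒≤ₗₑₓ (inj₁ (refl , refl))            = ≤ₗₑₓ-refl
≡⊎precedes⇒≤ₗₑₓ (inj₂ (inj₁ c+d<a+b))           = inj₁ c+d<a+b
≡⊎precedes⇒≤ₗₑₓ (inj₂ (inj₂ (c+d≡a+b , d<b)))   = inj₂ (c+d≡a+b , <⇒≤ d<b)

+ₚ1-≤ₗₑₓ-suc : ∀ {p m n} → p ≤ₗₑₓ (m , n) → p +ₚ (1 , 0) ≤ₗₑₓ (suc m , n)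
+ₚ1-≤ₗₑₓ-suc {p₁ , p₂} {m} {n} (inj₁ p₁<m)          = inj₁ (subst (_< suc m) (+-comm 1 p₁) (s≤s p₁<m))
+ₚ1-≤ₗₑₓ-suc {p₁ , p₂} {m} {n} (inj₂ (refl , p₂≤n)) = inj₂ (+-comm p₁ 1 , subst (_≤ n) (sym (+-identityʳ p₂)) p₂≤n)

+ₚ1-≤ₗₑₓ-suc⁻¹ : ∀ {p m n} → p +ₚ (1 , 0) ≤ₗₑₓ (suc m , n) → p ≤ₗₑₓ (m , n)
+ₚ1-≤ₗₑₓ-suc⁻¹ {p₁ , p₂} {m} {n} (inj₁ p₁+1<1+m) =
  inj₁ (≤-pred (subst (_< suc m) (+-comm p₁ 1) p₁+1<1+m))
+ₚ1-≤ₗₑₓ-suc⁻¹ {p₁ , p₂} {m} {n} (inj₂ (p₁+1≡1+m , p₂+0≤n)) =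
  inj₂ (suc-injective (trans (+-comm 1 p₁) p₁+1≡1+m) , subst (_≤ n) (+-identityʳ p₂) p₂+0≤n)

+ₚ1-≰ₗₑₓ-zero : ∀ {p n} → p +ₚ (1 , 0) ≤ₗₑₓ (0 , n) → ⊥
+ₚ1-≰ₗₑₓ-zero {p₁ , p₂} (inj₁ p₁+1<0)       = n≮0 p₁+1<0
+ₚ1-≰ₗₑₓ-zero {p₁ , p₂} (inj₂ (p₁+1≡0 , _)) = 1+n≢0 (trans (+-comm 1 p₁) p₁+1≡0)

-- In (c + d , d) the second coordinate never exceeds the first.
key-≤ₗₑₓ-narrow : ∀ {c d m} → (c + d , d) ≤ₗₑₓ (m , suc m) → (c + d , d) ≤ₗₑₓ (m , m)
key-≤ₗₑₓ-narrow     (inj₁ c+d<m)        = inj₁ c+d<m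
key-≤ₗₑₓ-narrow {c} (inj₂ (refl , _))   = inj₂ (refl , m≤n+m _ c)

br-aOf-bOf : ∀ x → suc (2 * x) ≡ br (aOf x) (bOf x)
br-aOf-bOf x = trans (cong (λ z → suc (2 * z)) (sym (interleave-aOf-bOf x))) (sym (br≡1+2*interleave (aOf x) (bOf x)))

br⇒≡interleave : ∀ {x c d} → suc (2 * x) ≡ br c d → x ≡ interleave c d
br⇒≡interleave {x} {c} {d} eq = *-cancelˡ-≡ x (interleave c d) 2 (suc-injective (trans eq (br≡1+2*interleave c d)))

key-br : ∀ {x c d} → suc (2 * x) ≡ br c d → key x ≡ (c + d , d)
key-br {x} {c} {d} eq = trans (cong key (br⇒≡interleave {x} {c} {d} eq)) (key-interleave c d)

-- (1α) for A_(1 + 2 e) is KeyBounded e together with HasLead e.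
KeyBoundedBy : ℕ × ℕ → Poly → Set
KeyBoundedBy κ p = ∀ x → p (suc (2 * x)) ≡ true → key x +ₚ (1 , 0) ≤ₗₑₓ κ

KeyBounded : ℕ → Poly → Set
KeyBounded e = KeyBoundedBy (key e)

lead : ℕ → ℕ
lead e = interleave (aOf e ∸ 1) (bOf e)

HasLead : ℕ → Poly → Set
HasLead e p = 1 ≤ aOf e → p (suc (2 * lead e)) ≡ true

key-lead : ∀ e → 1 ≤ aOf e → key (lead e) +ₚ (1 , 0) ≡ key e
key-lead e 1≤a = trans (cong (_+ₚ (1 , 0)) (key-interleave (aOf e ∸ 1) (bOf e)))
                       (cong₂ _,_ (trans (regroup (aOf e ∸ 1) (bOf e)) (cong (_+ bOf e) (m∸n+n≡m 1≤a)))
                                  (+-identityʳ (bOf e)))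
  where
  regroup : ∀ a b → a + b + 1 ≡ a + 1 + b
  regroup = solve-∀

key+1≡⇒lead : ∀ x m → key x +ₚ (1 , 0) ≡ key m → 1 ≤ aOf m × x ≡ lead m
key+1≡⇒lead x m eq = 1≤a , x≡
  where
  b≡ : bOf x ≡ bOf m
  b≡ = trans (sym (+-identityʳ (bOf x))) (cong proj₂ eq)
  a+1≡ : aOf x + 1 ≡ aOf m
  a+1≡ = +-cancelʳ-≡ (bOf m) _ _ (begin
    aOf x + 1 + bOf m      ≡⟨ cong (aOf x + 1 +_) (sym b≡) ⟩
    aOf x + 1 + bOf x      ≡⟨ swap (aOf x) 1 (bOf x) ⟩
    aOf x + bOf x + 1      ≡⟨ cong proj₁ eq ⟩
    aOf m + bOf m          ∎)
    where
    open ≡-Reasoning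
    swap : ∀ a b c → a + b + c ≡ a + c + b
    swap = solve-∀
  1≤a : 1 ≤ aOf m
  1≤a = subst (1 ≤_) a+1≡ (m≤n+m 1 (aOf x))
  x≡ : x ≡ lead m
  x≡ = begin
    x                                ≡⟨ sym (interleave-aOf-bOf x) ⟩
    interleave (aOf x) (bOf x)       ≡⟨ cong₂ interleave (trans (sym (m+n∸n≡m (aOf x) 1)) (cong (_∸ 1) a+1≡)) b≡ ⟩
    interleave (aOf m ∸ 1) (bOf m)   ∎
    where open ≡-Reasoning

module _ (e : ℕ) (p : Poly) where

  private
    coords : suc (2 * e) ≡ br (aOf e) (bOf e)
    coords = br-aOf-bOf e

  cond1α⇒keyBounded : Cond1α (suc (2 * e)) p → KeyBounded e p
  cond1α⇒keyBounded cond x px = bound (aOf e) (bOf e) coords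
    where
    key≤ : ∀ {c d a b} → suc (2 * x) ≡ br c d → (c ≡ a × d ≡ b) ⊎ Precedes c d a b →
           key x ≤ₗₑₓ (a + b , b)
    key≤ {c} {d} {a} {b} k≡ rel = subst (_≤ₗₑₓ (a + b , b)) (sym (key-br {x} {c} {d} k≡)) (≡⊎precedes⇒≤ₗₑₓ rel)
    bound : ∀ a b → suc (2 * e) ≡ br a b → key x +ₚ (1 , 0) ≤ₗₑₓ (a + b , b)
    bound zero    zero     n≡ with cond 0 0 n≡ (suc (2 * x)) px
    ... | ()
    bound zero    (suc b') n≡ with cond 0 (suc b') n≡ (suc (2 * x)) px
    ... | c , d , k≡ , rel = ≤ₗₑₓ-trans (+ₚ1-≤ₗₑₓ-suc (key≤ k≡ rel)) (inj₂ (refl , n≤1+n b'))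
    bound (suc a') b        n≡ with proj₂ (cond (suc a') b n≡) (suc (2 * x)) px
    ... | inj₁ k≡                  = +ₚ1-≤ₗₑₓ-suc (key≤ k≡ (inj₁ (refl , refl)))
    ... | inj₂ (c , d , k≡ , prec) = +ₚ1-≤ₗₑₓ-suc (key≤ k≡ (inj₂ prec))

  cond1α⇒hasLead : Cond1α (suc (2 * e)) p → HasLead e p
  cond1α⇒hasLead cond = lead-present (aOf e) (bOf e) coords
    where
    lead-present : ∀ a b → suc (2 * e) ≡ br a b → 1 ≤ a → p (suc (2 * interleave (a ∸ 1) b)) ≡ true
    lead-present (suc a') b n≡ _ = subst (λ k → p k ≡ true) (br≡1+2*interleave a' b) (proj₁ (cond (suc a') b n≡))

  private
    monomial-key : OddPoly p → KeyBounded e p → ∀ a b → suc (2 * e) ≡ br a b → ∀ k → p k ≡ true →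
                   ∃[ x ] (k ≡ br (aOf x) (bOf x) × (aOf x + bOf x , bOf x) +ₚ (1 , 0) ≤ₗₑₓ (a + b , b))
    monomial-key oddP bounded a b n≡ k pk with oddP k pk
    ... | x , refl = x , br-aOf-bOf x , subst (key x +ₚ (1 , 0) ≤ₗₑₓ_) (key-br {e} {a} {b} n≡) (bounded x pk)

  keyBounded×hasLead⇒cond1α : OddPoly p → KeyBounded e p → HasLead e p → Cond1α (suc (2 * e)) p
  keyBounded×hasLead⇒cond1α oddP bounded hasLead zero zero n≡ k pk
    with monomial-key oddP bounded 0 0 n≡ k pk
  ... | _ , _ , bnd = ⊥-elim (+ₚ1-≰ₗₑₓ-zero bnd)
  keyBounded×hasLead⇒cond1α oddP bounded hasLead zero (suc b') n≡ k pk
    with monomial-key oddP bounded 0 (suc b') n≡ k pk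
  ... | x , k≡ , bnd = aOf x , bOf x , k≡ , ≤ₗₑₓ⇒≡⊎precedes (key-≤ₗₑₓ-narrow (+ₚ1-≤ₗₑₓ-suc⁻¹ bnd))
  keyBounded×hasLead⇒cond1α oddP bounded hasLead (suc a') b n≡ = leading , others
    where
    e≡ : e ≡ interleave (suc a') b
    e≡ = br⇒≡interleave {e} {suc a'} {b} n≡
    aOf-e : aOf e ≡ suc a'
    aOf-e = trans (cong aOf e≡) (aOf-interleave (suc a') b)
    bOf-e : bOf e ≡ b
    bOf-e = trans (cong bOf e≡) (bOf-interleave (suc a') b)
    lead≡ : suc (2 * lead e) ≡ br a' b
    lead≡ = trans (cong₂ (λ u v → suc (2 * interleave (u ∸ 1) v)) aOf-e bOf-e) (sym (br≡1+2*interleave a' b))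
    leading : p (br a' b) ≡ true
    leading = subst (λ k → p k ≡ true) lead≡ (hasLead (subst (1 ≤_) (sym aOf-e) (s≤s z≤n)))
    others : ∀ k → p k ≡ true → k ≡ br a' b ⊎ (∃[ c ] ∃[ d ] (k ≡ br c d × Precedes c d a' b))
    others k pk with monomial-key oddP bounded (suc a') b n≡ k pk
    ... | x , k≡ , bnd with ≤ₗₑₓ⇒≡⊎precedes (+ₚ1-≤ₗₑₓ-suc⁻¹ bnd)
    ...   | inj₁ (c≡a' , d≡b) = inj₁ (trans k≡ (cong₂ br c≡a' d≡b))
    ...   | inj₂ prec          = inj₂ (aOf x , bOf x , k≡ , prec)

-- Growth of g

g-2^j*x+y : ∀ j x y → y < 2 ^ j → g (2 ^ j * x + y) ≡ 4 ^ j * g x + g y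
g-2^j*x+y zero    x zero    _ = trans (cong g (trans (+-identityʳ _) (*-identityˡ x)))
                                      (sym (trans (+-identityʳ _) (*-identityˡ (g x))))
g-2^j*x+y zero    x (suc y) (s≤s ())
g-2^j*x+y (suc j) x y y<2^[1+j] = begin
  g (2 ^ suc j * x + y)                ≡⟨ cong (λ z → g (2 ^ suc j * x + z)) (m≡m%n+n*[m/n] y 2) ⟩
  g (2 * 2 ^ j * x + (β + 2 * y'))     ≡⟨ cong g (regroup β (2 ^ j) x y') ⟩
  g (β + 2 * (2 ^ j * x + y'))         ≡⟨ g-digit β (2 ^ j * x + y') β<2 ⟩
  β + 4 * g (2 ^ j * x + y')           ≡⟨ cong (λ z → β + 4 * z) (g-2^j*x+y j x y' y'<2^j) ⟩
  β + 4 * (4 ^ j * g x + g y')         ≡⟨ regroup′ β (g x) (4 ^ j) (g y') ⟩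
  4 ^ suc j * g x + (β + 4 * g y')     ≡⟨ cong (4 ^ suc j * g x +_) (sym (g-digit β y' β<2)) ⟩
  4 ^ suc j * g x + g (β + 2 * y')     ≡⟨ cong (λ z → 4 ^ suc j * g x + g z) (sym (m≡m%n+n*[m/n] y 2)) ⟩
  4 ^ suc j * g x + g y                ∎
  where
  open ≡-Reasoning
  β = y % 2
  y' = y / 2
  β<2 = m%n<n y 2
  y'<2^j : y' < 2 ^ j
  y'<2^j = m<n*o⇒m/o<n (subst (y <_) (*-comm 2 (2 ^ j)) y<2^[1+j])
  regroup : ∀ β P x y → 2 * P * x + (β + 2 * y) ≡ β + 2 * (P * x + y)
  regroup = solve-∀
  regroup′ : ∀ β G Q Y → β + 4 * (Q * G + Y) ≡ (4 * Q) * G + (β + 4 * Y)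
  regroup′ = solve-∀

g-2^j+y : ∀ j y → y < 2 ^ j → g (2 ^ j + y) ≡ 4 ^ j + g y
g-2^j+y j y y<2^j =
  trans (cong (λ z → g (z + y)) (sym (*-identityʳ (2 ^ j))))
        (trans (g-2^j*x+y j 1 y y<2^j) (cong (_+ g y) (*-identityʳ (4 ^ j))))

g-2^j : ∀ j → g (2 ^ j) ≡ 4 ^ j
g-2^j j = trans (cong g (sym (+-identityʳ (2 ^ j))))
                (trans (g-2^j+y j 0 (m^n>0 2 j)) (+-identityʳ (4 ^ j)))

interleave-2^j+ˡ : ∀ j a b → a < 2 ^ j → interleave (2 ^ j + a) b ≡ 4 ^ j + interleave a b
interleave-2^j+ˡ j a b a<2^j = trans (cong (_+ 2 * g b) (g-2^j+y j a a<2^j)) (+-assoc (4 ^ j) (g a) (2 * g b))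

interleave-2^j+ʳ : ∀ j a b → b < 2 ^ j → interleave a (2 ^ j + b) ≡ 2 * 4 ^ j + interleave a b
interleave-2^j+ʳ j a b b<2^j = begin
  g a + 2 * g (2 ^ j + b)      ≡⟨ cong (λ z → g a + 2 * z) (g-2^j+y j b b<2^j) ⟩
  g a + 2 * (4 ^ j + g b)      ≡⟨ regroup (g a) (4 ^ j) (g b) ⟩
  2 * 4 ^ j + (g a + 2 * g b)  ∎
  where
  open ≡-Reasoning
  regroup : ∀ x K y → x + 2 * (K + y) ≡ 2 * K + (x + 2 * y)
  regroup = solve-∀

key-4^j : ∀ j → key (4 ^ j) ≡ (2 ^ j , 0)
key-4^j j = trans (cong key 4^j≡) (trans (key-interleave (2 ^ j) 0) (cong (_, 0) (+-identityʳ (2 ^ j))))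
  where
  4^j≡ : 4 ^ j ≡ interleave (2 ^ j) 0
  4^j≡ = sym (trans (+-identityʳ (g (2 ^ j))) (g-2^j j))

key-2*4^j : ∀ j → key (2 * 4 ^ j) ≡ (2 ^ j , 2 ^ j)
key-2*4^j j = trans (cong (λ z → key (2 * z)) (sym (g-2^j j))) (key-interleave 0 (2 ^ j))

module _ (j e : ℕ) (b<2^j : bOf e < 2 ^ j) where

  private
    coords : 2 * 4 ^ j + e ≡ interleave (aOf e) (2 ^ j + bOf e)
    coords = trans (cong (2 * 4 ^ j +_) (sym (interleave-aOf-bOf e)))
                   (sym (interleave-2^j+ʳ j (aOf e) (bOf e) b<2^j))

  aOf-2*4^j+ : aOf (2 * 4 ^ j + e) ≡ aOf e
  aOf-2*4^j+ = trans (cong aOf coords) (aOf-interleave (aOf e) (2 ^ j + bOf e))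

  bOf-2*4^j+ : bOf (2 * 4 ^ j + e) ≡ 2 ^ j + bOf e
  bOf-2*4^j+ = trans (cong bOf coords) (bOf-interleave (aOf e) (2 ^ j + bOf e))

  key-2*4^j+ : key (2 * 4 ^ j + e) ≡ key e +ₚ key (2 * 4 ^ j)
  key-2*4^j+ = begin
    key (2 * 4 ^ j + e)                               ≡⟨ cong₂ (λ a b → (a + b , b)) aOf-2*4^j+ bOf-2*4^j+ ⟩
    (aOf e + (2 ^ j + bOf e) , 2 ^ j + bOf e)         ≡⟨ cong₂ _,_ (regroup (aOf e) (bOf e) (2 ^ j)) (+-comm (2 ^ j) (bOf e)) ⟩
    (aOf e + bOf e + 2 ^ j , bOf e + 2 ^ j)           ≡⟨ cong (key e +ₚ_) (sym (key-2*4^j j)) ⟩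
    key e +ₚ key (2 * 4 ^ j)                          ∎
    where
    open ≡-Reasoning
    regroup : ∀ a b P → a + (P + b) ≡ a + b + P
    regroup = solve-∀

  lead-2*4^j+ : lead (2 * 4 ^ j + e) ≡ lead e + 2 * 4 ^ j
  lead-2*4^j+ = begin
    interleave (aOf (2 * 4 ^ j + e) ∸ 1) (bOf (2 * 4 ^ j + e)) ≡⟨ cong₂ (λ a b → interleave (a ∸ 1) b) aOf-2*4^j+ bOf-2*4^j+ ⟩
    interleave (aOf e ∸ 1) (2 ^ j + bOf e)                      ≡⟨ interleave-2^j+ʳ j (aOf e ∸ 1) (bOf e) b<2^j ⟩
    2 * 4 ^ j + lead e                                          ≡⟨ +-comm (2 * 4 ^ j) (lead e) ⟩
    lead e + 2 * 4 ^ j                                          ∎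
    where open ≡-Reasoning

module _ (j e : ℕ) (a<2^j : aOf e < 2 ^ j) where

  private
    coords : 4 ^ j + e ≡ interleave (2 ^ j + aOf e) (bOf e)
    coords = trans (cong (4 ^ j +_) (sym (interleave-aOf-bOf e)))
                   (sym (interleave-2^j+ˡ j (aOf e) (bOf e) a<2^j))

  aOf-4^j+ : aOf (4 ^ j + e) ≡ 2 ^ j + aOf e
  aOf-4^j+ = trans (cong aOf coords) (aOf-interleave (2 ^ j + aOf e) (bOf e))

  bOf-4^j+ : bOf (4 ^ j + e) ≡ bOf e
  bOf-4^j+ = trans (cong bOf coords) (bOf-interleave (2 ^ j + aOf e) (bOf e))

  key-4^j+ : key (4 ^ j + e) ≡ key e +ₚ key (4 ^ j)
  key-4^j+ = begin
    key (4 ^ j + e)                     ≡⟨ cong₂ (λ a b → (a + b , b)) aOf-4^j+ bOf-4^j+ ⟩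
    (2 ^ j + aOf e + bOf e , bOf e)     ≡⟨ cong₂ _,_ (regroup (2 ^ j) (aOf e) (bOf e)) (sym (+-identityʳ (bOf e))) ⟩
    (aOf e + bOf e + 2 ^ j , bOf e + 0) ≡⟨ cong (key e +ₚ_) (sym (key-4^j j)) ⟩
    key e +ₚ key (4 ^ j)                ∎
    where
    open ≡-Reasoning
    regroup : ∀ P a b → P + a + b ≡ a + b + P
    regroup = solve-∀

  lead-4^j+ : 1 ≤ aOf e → lead (4 ^ j + e) ≡ lead e + 4 ^ j
  lead-4^j+ 1≤a = begin
    interleave (aOf (4 ^ j + e) ∸ 1) (bOf (4 ^ j + e)) ≡⟨ cong₂ (λ a b → interleave (a ∸ 1) b) aOf-4^j+ bOf-4^j+ ⟩
    interleave (2 ^ j + aOf e ∸ 1) (bOf e)             ≡⟨ cong (λ a → interleave a (bOf e)) (+-∸-assoc (2 ^ j) 1≤a) ⟩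
    interleave (2 ^ j + (aOf e ∸ 1)) (bOf e)           ≡⟨ interleave-2^j+ˡ j (aOf e ∸ 1) (bOf e) (≤-<-trans (m∸n≤m (aOf e) 1) a<2^j) ⟩
    4 ^ j + lead e                                     ≡⟨ +-comm (4 ^ j) (lead e) ⟩
    lead e + 4 ^ j                                     ∎
    where open ≡-Reasoning

lead-4^[1+j]+ : ∀ j e → aOf e ≡ 0 → lead (4 ^ suc j + e) ≡ lead (4 ^ j + e) + 4 ^ j
lead-4^[1+j]+ j e a≡0 = begin
  interleave (aOf (4 ^ suc j + e) ∸ 1) (bOf (4 ^ suc j + e))
    ≡⟨ cong₂ (λ a b → interleave (a ∸ 1) b) (trans (aOf-4^j+ (suc j) e a<2^[1+j]) (cong (2 ^ suc j +_) a≡0))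
                                             (bOf-4^j+ (suc j) e a<2^[1+j]) ⟩
  interleave (2 * P + 0 ∸ 1) (bOf e)
    ≡⟨ cong (λ a → interleave a (bOf e)) (trans (cong (_∸ 1) (double P)) (+-∸-assoc P 1≤P)) ⟩
  interleave (P + (P ∸ 1)) (bOf e)
    ≡⟨ interleave-2^j+ˡ j (P ∸ 1) (bOf e) (∸-monoʳ-< {P} {1} {0} (s≤s z≤n) 1≤P) ⟩
  4 ^ j + interleave (P ∸ 1) (bOf e)
    ≡⟨ cong₂ (λ a b → 4 ^ j + interleave (a ∸ 1) b)
             (sym (trans (aOf-4^j+ j e a<2^j) (trans (cong (P +_) a≡0) (+-identityʳ P))))
             (sym (bOf-4^j+ j e a<2^j)) ⟩
  4 ^ j + lead (4 ^ j + e)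
    ≡⟨ +-comm (4 ^ j) (lead (4 ^ j + e)) ⟩
  lead (4 ^ j + e) + 4 ^ j ∎
  where
  open ≡-Reasoning
  P = 2 ^ j
  1≤P : 1 ≤ P
  1≤P = m^n>0 2 j
  a<2^j : aOf e < 2 ^ j
  a<2^j = subst (_< 2 ^ j) (sym a≡0) 1≤P
  a<2^[1+j] : aOf e < 2 ^ suc j
  a<2^[1+j] = subst (_< 2 ^ suc j) (sym a≡0) (m^n>0 2 (suc j))
  double : ∀ P → 2 * P + 0 ≡ P + P
  double = solve-∀

key-gap-4^i : ∀ {R} i → R ≡ 4 ^ i → twice (key R) ≤ₗₑₓ key (8 * R) × twice (key R) ≢ key (8 * R)
key-gap-4^i {R} i R≡ = subst₂ _≤ₗₑₓ_ (sym twice-key-R) (sym key-8R) (inj₂ (refl , z≤n)) ,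
                       λ eq → <⇒≢ (m^n>0 2 (suc i)) (cong proj₂ (trans (sym twice-key-R) (trans eq key-8R)))
  where
  twice-key-R : twice (key R) ≡ (2 ^ suc i , 0)
  twice-key-R = trans (cong (λ z → twice (key z)) R≡)
                      (trans (cong twice (key-4^j i)) (cong (_, 0) (cong (2 ^ i +_) (sym (+-identityʳ (2 ^ i))))))
  key-8R : key (8 * R) ≡ (2 ^ suc i , 2 ^ suc i)
  key-8R = trans (cong key (trans (cong (8 *_) R≡) (regroup (4 ^ i)))) (key-2*4^j (suc i))
    where
    regroup : ∀ K → 8 * K ≡ 2 * (4 * K)
    regroup = solve-∀

key-gap-2*4^i : ∀ {R} i → R ≡ 2 * 4 ^ i → twice (key R) ≤ₗₑₓ key (8 * R) × twice (key R) ≢ key (8 * R)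
key-gap-2*4^i {R} i R≡ = subst₂ _≤ₗₑₓ_ (sym twice-key-R) (sym key-8R) (inj₁ P<2P) ,
                         λ eq → <⇒≢ P<2P (cong proj₁ (trans (sym twice-key-R) (trans eq key-8R)))
  where
  P = 2 ^ suc i
  P<2P : P < 2 * P
  P<2P = subst (P <_) (cong (P +_) (sym (+-identityʳ P))) (m<m+n P (m^n>0 2 (suc i)))
  twice-key-R : twice (key R) ≡ (P , P)
  twice-key-R = trans (cong (λ z → twice (key z)) R≡) (trans (cong twice (key-2*4^j i)) (cong₂ _,_ P≡ P≡))
    where
    P≡ : 2 ^ i + 2 ^ i ≡ P
    P≡ = cong (2 ^ i +_) (sym (+-identityʳ (2 ^ i)))
  key-8R : key (8 * R) ≡ (2 * P , 0)
  key-8R = trans (cong key (trans (cong (8 *_) R≡) (regroup (4 ^ i)))) (key-4^j (suc (suc i)))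
    where
    regroup : ∀ K → 8 * (2 * K) ≡ 4 * (4 * K)
    regroup = solve-∀

g-<-suc : ∀ x → g x < g (suc x)
g-<-suc = <-rec _ step
  where
  step : ∀ x → (∀ {y} → y < x → g y < g (suc y)) → g x < g (suc x)
  step x ih with x % 2 | m%n<n x 2 | m≡m%n+n*[m/n] x 2
  ... | zero | _ | x≡ = begin-strict
    g x                  ≡⟨ cong g x≡ ⟩
    g (0 + 2 * x')       ≡⟨ g-digit 0 x' (s≤s z≤n) ⟩
    4 * g x'             <⟨ n<1+n (4 * g x') ⟩
    1 + 4 * g x'         ≡⟨ sym (g-digit 1 x' (s≤s (s≤s z≤n))) ⟩
    g (1 + 2 * x')       ≡⟨ cong (λ z → g (suc z)) (sym x≡) ⟩
    g (suc x)            ∎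
    where
    open ≤-Reasoning
    x' = x / 2
  ... | suc zero | _ | x≡ = begin-strict
    g x                  ≡⟨ cong g x≡ ⟩
    g (1 + 2 * x')       ≡⟨ g-digit 1 x' (s≤s (s≤s z≤n)) ⟩
    1 + 4 * g x'         <⟨ +-monoˡ-≤ (4 * g x') (s≤s (s≤s (z≤n {2}))) ⟩
    4 + 4 * g x'         ≡⟨ sym (*-suc 4 (g x')) ⟩
    4 * suc (g x')       ≤⟨ *-monoʳ-≤ 4 (ih x'<x) ⟩
    4 * g (suc x')       ≡⟨ sym (g-digit 0 (suc x') (s≤s z≤n)) ⟩
    g (2 * suc x')       ≡⟨ cong g (*-suc 2 x') ⟩
    g (2 + 2 * x')       ≡⟨ cong (λ z → g (suc z)) (sym x≡) ⟩
    g (suc x)            ∎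
    where
    open ≤-Reasoning
    x' = x / 2
    x'<x : x' < x
    x'<x = subst (x' <_) (sym x≡) (s≤s (m≤m+n x' (x' + 0)))
  ... | suc (suc _) | s≤s (s≤s ()) | _

g-mono-≤ : ∀ {x y} → x ≤ y → g x ≤ g y
g-mono-≤ x≤y = go (≤⇒≤′ x≤y)
  where
  go : ∀ {x y} → x ≤′ y → g x ≤ g y
  go ≤′-refl        = ≤-refl
  go {y = suc y} (≤′-step x≤′y) = ≤-trans (go x≤′y) (<⇒≤ (g-<-suc y))

aOf<2^t : ∀ t e → e < 4 ^ t → aOf e < 2 ^ t
aOf<2^t t e e<4^t = ≰⇒> λ 2^t≤a → <⇒≱ e<4^t (begin
  4 ^ t                      ≡⟨ sym (g-2^j t) ⟩
  g (2 ^ t)                  ≤⟨ g-mono-≤ 2^t≤a ⟩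
  g (aOf e)                  ≤⟨ m≤m+n (g (aOf e)) (2 * g (bOf e)) ⟩
  interleave (aOf e) (bOf e) ≡⟨ interleave-aOf-bOf e ⟩
  e                          ∎)
  where open ≤-Reasoning

bOf<2^t : ∀ t e → e < 2 * 4 ^ t → bOf e < 2 ^ t
bOf<2^t t e e<2*4^t = ≰⇒> λ 2^t≤b → <⇒≱ e<2*4^t (begin
  2 * 4 ^ t                  ≡⟨ cong (2 *_) (sym (g-2^j t)) ⟩
  2 * g (2 ^ t)              ≤⟨ *-monoʳ-≤ 2 (g-mono-≤ 2^t≤b) ⟩
  2 * g (bOf e)              ≤⟨ m≤n+m (2 * g (bOf e)) (g (aOf e)) ⟩
  interleave (aOf e) (bOf e) ≡⟨ interleave-aOf-bOf e ⟩
  e                          ∎)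
  where open ≤-Reasoning

3*g+1≤4^t : ∀ t a → a < 2 ^ t → 3 * g a + 1 ≤ 4 ^ t
3*g+1≤4^t zero    zero    _        = ≤-refl
3*g+1≤4^t zero    (suc a) (s≤s ())
3*g+1≤4^t (suc t) a a<2^[1+t] = begin
  3 * g a + 1                 ≡⟨ cong (λ z → 3 * g z + 1) (m≡m%n+n*[m/n] a 2) ⟩
  3 * g (β + 2 * a') + 1      ≡⟨ cong (λ z → 3 * z + 1) (g-digit β a' β<2) ⟩
  3 * (β + 4 * g a') + 1      ≤⟨ +-monoˡ-≤ 1 (*-monoʳ-≤ 3 (+-monoˡ-≤ (4 * g a') (≤-pred β<2))) ⟩
  3 * (1 + 4 * g a') + 1      ≡⟨ regroup (g a') ⟩
  4 * (3 * g a' + 1)          ≤⟨ *-monoʳ-≤ 4 (3*g+1≤4^t t a' a'<2^t) ⟩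
  4 * 4 ^ t                   ∎
  where
  open ≤-Reasoning
  β = a % 2
  a' = a / 2
  β<2 = m%n<n a 2
  a'<2^t : a' < 2 ^ t
  a'<2^t = m<n*o⇒m/o<n (subst (a <_) (*-comm 2 (2 ^ t)) a<2^[1+t])
  regroup : ∀ z → 3 * (1 + 4 * z) + 1 ≡ 4 * (3 * z + 1)
  regroup = solve-∀

jump : ℕ → ℕ
jump a = g a ∸ g (a ∸ 1)

g-pred+jump : ∀ a → 1 ≤ a → g (a ∸ 1) + jump a ≡ g a
g-pred+jump (suc a) _ = m+[n∸m]≡n (<⇒≤ (g-<-suc a))

jump-pos : ∀ a → 1 ≤ a → 1 ≤ jump a
jump-pos (suc a) _ = m<n⇒0<n∸m (g-<-suc a)

jump≤g : ∀ a → jump a ≤ g a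
jump≤g a = m∸n≤m (g a) (g (a ∸ 1))

jump-odd : ∀ x → jump (1 + 2 * x) ≡ 1
jump-odd x = trans (cong₂ _∸_ (g-digit 1 x (s≤s (s≤s z≤n))) (g-digit 0 x (s≤s z≤n))) (m+n∸n≡m 1 (4 * g x))

jump-even : ∀ x → 1 ≤ x → jump (2 * x) + 1 ≡ 4 * jump x
jump-even (suc x) _ = +-cancelˡ-≡ (4 * g x) _ _ (begin
  4 * g x + (jump (2 * suc x) + 1)        ≡⟨ regroup (g x) (jump (2 * suc x)) ⟩
  (1 + 4 * g x) + jump (2 * suc x)        ≡⟨ cong (_+ jump (2 * suc x)) (sym (g-digit 1 x (s≤s (s≤s z≤n)))) ⟩
  g (1 + 2 * x) + jump (2 * suc x)        ≡⟨ cong (λ z → g z + jump (2 * suc x)) (sym (pred-2*suc x)) ⟩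
  g (2 * suc x ∸ 1) + jump (2 * suc x)    ≡⟨ g-pred+jump (2 * suc x) (s≤s z≤n) ⟩
  g (2 * suc x)                           ≡⟨ g-digit 0 (suc x) (s≤s z≤n) ⟩
  4 * g (suc x)                           ≡⟨ cong (4 *_) (sym (g-pred+jump (suc x) (s≤s z≤n))) ⟩
  4 * (g x + jump (suc x))                ≡⟨ *-distribˡ-+ 4 (g x) (jump (suc x)) ⟩
  4 * g x + 4 * jump (suc x)              ∎)
  where
  open ≡-Reasoning
  regroup : ∀ G J → 4 * G + (J + 1) ≡ (1 + 4 * G) + J
  regroup = solve-∀
  pred-2*suc : ∀ x → 2 * suc x ∸ 1 ≡ 1 + 2 * x
  pred-2*suc x = cong (_∸ 1) (*-suc 2 x)

jump-cases : ∀ x → 1 ≤ x → jump x ≡ 1 ⊎ ∃[ x' ] (1 ≤ x' × jump x + 1 ≡ 4 * jump x')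
jump-cases x 1≤x with x % 2 | m%n<n x 2 | m≡m%n+n*[m/n] x 2
... | zero        | _            | x≡ = inj₂ (x / 2 , 1≤x/2 , trans (cong (λ z → jump z + 1) x≡) (jump-even (x / 2) 1≤x/2))
  where
  1≤x/2 : 1 ≤ x / 2
  1≤x/2 = n≢0⇒n>0 λ x/2≡0 → <⇒≢ 1≤x (sym (trans x≡ (cong (2 *_) x/2≡0)))
... | suc zero    | _            | x≡ = inj₁ (trans (cong jump x≡) (jump-odd (x / 2)))
... | suc (suc _) | s≤s (s≤s ()) | _

jump-odd-valued : ∀ x → 1 ≤ x → ∃[ t ] jump x ≡ suc (2 * t)
jump-odd-valued x 1≤x with jump-cases x 1≤x
... | inj₁ j≡1 = 0 , j≡1
... | inj₂ (x' , 1≤x' , j+1≡4j') with jump x' | jump-pos x' 1≤x'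
...   | suc j' | _ = 1 + 2 * j' , +-cancelʳ-≡ 1 _ _ (trans j+1≡4j' (regroup j'))
  where
  regroup : ∀ j → 4 * suc j ≡ suc (2 * (1 + 2 * j)) + 1
  regroup = solve-∀

-- jump a = (2·4^v + 1)/3 where 2^v is the largest power of 2 dividing a.
jump≢jump+4^k : ∀ k x y → 1 ≤ x → 1 ≤ y → jump x ≢ jump y + 4 ^ k
jump≢jump+4^k zero x y 1≤x 1≤y jx≡jy+1 with jump-odd-valued x 1≤x | jump-odd-valued y 1≤y
... | s , jx≡ | t , jy≡ = even≢odd (suc t) s (sym (suc-injective (begin
  suc (suc (2 * s))        ≡⟨ cong suc (sym jx≡) ⟩
  suc (jump x)             ≡⟨ cong suc jx≡jy+1 ⟩
  suc (jump y + 1)         ≡⟨ cong (λ z → suc (z + 1)) jy≡ ⟩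
  suc (suc (2 * t) + 1)    ≡⟨ cong suc (+-comm (suc (2 * t)) 1) ⟩
  suc (2 + 2 * t)          ≡⟨ cong suc (sym (*-suc 2 t)) ⟩
  suc (2 * suc t)          ∎)))
  where open ≡-Reasoning
jump≢jump+4^k (suc k) x y 1≤x 1≤y jx≡ with jump-cases x 1≤x | jump-cases y 1≤y
... | inj₁ jx≡1 | _ =
  <⇒≱ (+-mono-≤-< (jump-pos y 1≤y) (*-monoʳ-< 4 (m^n>0 4 k))) (≤-reflexive (trans (sym jx≡) jx≡1))
... | inj₂ (x' , _ , jx+1≡) | inj₁ jy≡1 = even≢odd (jump x') (4 ^ k) (*-cancelˡ-≡ _ _ 2 (begin
  2 * (2 * jump x')          ≡⟨ double (jump x') ⟩
  4 * jump x'                ≡⟨ sym jx+1≡ ⟩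
  jump x + 1                 ≡⟨ cong (_+ 1) (trans jx≡ (cong (_+ 4 ^ suc k) jy≡1)) ⟩
  1 + 4 * 4 ^ k + 1          ≡⟨ regroup (4 ^ k) ⟩
  2 * suc (2 * 4 ^ k)        ∎))
  where
  open ≡-Reasoning
  double : ∀ j → 2 * (2 * j) ≡ 4 * j
  double = solve-∀
  regroup : ∀ K → 1 + 4 * K + 1 ≡ 2 * suc (2 * K)
  regroup = solve-∀
... | inj₂ (x' , 1≤x' , jx+1≡) | inj₂ (y' , 1≤y' , jy+1≡) =
  jump≢jump+4^k k x' y' 1≤x' 1≤y' (*-cancelˡ-≡ _ _ 4 (begin
  4 * jump x'                ≡⟨ sym jx+1≡ ⟩
  jump x + 1                 ≡⟨ cong (_+ 1) jx≡ ⟩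
  jump y + 4 * 4 ^ k + 1     ≡⟨ regroup (jump y) (4 ^ k) ⟩
  (jump y + 1) + 4 * 4 ^ k   ≡⟨ cong (_+ 4 * 4 ^ k) jy+1≡ ⟩
  4 * jump y' + 4 * 4 ^ k    ≡⟨ sym (*-distribˡ-+ 4 (jump y') (4 ^ k)) ⟩
  4 * (jump y' + 4 ^ k)      ∎))
  where
  open ≡-Reasoning
  regroup : ∀ J K → J + 4 * K + 1 ≡ (J + 1) + 4 * K
  regroup = solve-∀

jump-2^j+y : ∀ j y → 1 ≤ y → y < 2 ^ j → jump (2 ^ j + y) ≡ jump y
jump-2^j+y j (suc y) _ 1+y<2^j = begin
  g (2 ^ j + suc y) ∸ g (2 ^ j + suc y ∸ 1) ≡⟨ cong₂ _∸_ (g-2^j+y j (suc y) 1+y<2^j)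
                                                       (trans (cong g (+-∸-assoc (2 ^ j) (s≤s (z≤n {y}))))
                                                              (g-2^j+y j y (<-trans (n<1+n y) 1+y<2^j))) ⟩
  (4 ^ j + g (suc y)) ∸ (4 ^ j + g y)       ≡⟨ [m+n]∸[m+o]≡n∸o (4 ^ j) (g (suc y)) (g y) ⟩
  jump (suc y)                              ∎
  where open ≡-Reasoning

lead+jump : ∀ e → 1 ≤ aOf e → lead e + jump (aOf e) ≡ e
lead+jump e 1≤a = begin
  g (aOf e ∸ 1) + 2 * g (bOf e) + jump (aOf e) ≡⟨ regroup (g (aOf e ∸ 1)) (2 * g (bOf e)) (jump (aOf e)) ⟩
  g (aOf e ∸ 1) + jump (aOf e) + 2 * g (bOf e) ≡⟨ cong (_+ 2 * g (bOf e)) (g-pred+jump (aOf e) 1≤a) ⟩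
  interleave (aOf e) (bOf e)                   ≡⟨ interleave-aOf-bOf e ⟩
  e                                            ∎
  where
  open ≡-Reasoning
  regroup : ∀ a b c → a + b + c ≡ a + c + b
  regroup = solve-∀

-- Shifts and the recurrence

shift-cong : ∀ m {p q : Poly} → (∀ k → p k ≡ q k) → ∀ k → shift m p k ≡ shift m q k
shift-cong m p≗q k with k <ᵇ m
... | true  = refl
... | false = p≗q (k ∸ m)

shift-⊕ : ∀ m (p q : Poly) k → shift m (p ⊕ q) k ≡ shift m p k xor shift m q k
shift-⊕ m p q k with k <ᵇ m
... | true  = refl
... | false = refl

shift-< : ∀ {m k} (p : Poly) → k < m → shift m p k ≡ false
shift-< {m} {k} p k<m with k <ᵇ m | <⇒<ᵇ k<m
... | true | _ = refl

shift-≥ : ∀ {m k} (p : Poly) → m ≤ k → shift m p k ≡ p (k ∸ m)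
shift-≥ {m} {k} p m≤k with k <ᵇ m | <ᵇ⇒< k m
... | false | _     = refl
... | true  | k<m   = contradiction (k<m _) (≤⇒≯ m≤k)

shift-shift : ∀ m n (p : Poly) k → shift m (shift n p) k ≡ shift (m + n) p k
shift-shift m n p k with k <? m
... | yes k<m = trans (shift-< (shift n p) k<m) (sym (shift-< p (<-≤-trans k<m (m≤m+n m n))))
... | no  k≮m with k ∸ m <? n
...   | yes k∸m<n = begin
  shift m (shift n p) k   ≡⟨ shift-≥ (shift n p) m≤k ⟩
  shift n p (k ∸ m)       ≡⟨ shift-< p k∸m<n ⟩
  false                   ≡⟨ sym (shift-< p (subst (_< m + n) (m+[n∸m]≡n m≤k) (+-monoʳ-< m k∸m<n))) ⟩
  shift (m + n) p k       ∎
  where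
  open ≡-Reasoning
  m≤k = ≮⇒≥ k≮m
...   | no  k∸m≮n = begin
  shift m (shift n p) k   ≡⟨ shift-≥ (shift n p) m≤k ⟩
  shift n p (k ∸ m)       ≡⟨ shift-≥ p (≮⇒≥ k∸m≮n) ⟩
  p (k ∸ m ∸ n)           ≡⟨ cong p (∸-+-assoc k m n) ⟩
  p (k ∸ (m + n))         ≡⟨ sym (shift-≥ p (subst (m + n ≤_) (m+[n∸m]≡n m≤k) (+-monoʳ-≤ m (≮⇒≥ k∸m≮n)))) ⟩
  shift (m + n) p k       ∎
  where
  open ≡-Reasoning
  m≤k = ≮⇒≥ k≮m

Recurrence : ℕ → (ℕ → Poly) → Set
Recurrence r A = ∀ n → Odd n → ∀ k →
  A (n + 16 * r) k ≡ (shift (16 * r) (A n) ⊕ shift (4 * r) (A (n + 4 * r)) ⊕ shift (2 * r) (A (n + 2 * r))) k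

odd+even : ∀ {n} → Odd n → ∀ m → Odd (n + 2 * m)
odd+even (t , refl) m = t + m , cong suc (sym (*-distribˡ-+ 2 t m))

shift-recurrence : ∀ {r A} → Recurrence r A → ∀ a m → Odd m → ∀ k →
                   shift a (A (m + 16 * r)) k ≡
                     (shift (a + 16 * r) (A m) k xor shift (a + 4 * r) (A (m + 4 * r)) k) xor shift (a + 2 * r) (A (m + 2 * r)) k
shift-recurrence {r} {A} rec a m odd-m k = begin
  shift a (A (m + 16 * r)) k                       ≡⟨ shift-cong a (rec m odd-m) k ⟩
  shift a (P₁₆ ⊕ P₄ ⊕ P₂) k                        ≡⟨ shift-⊕ a (P₁₆ ⊕ P₄) P₂ k ⟩
  shift a (P₁₆ ⊕ P₄) k xor shift a P₂ k            ≡⟨ cong (_xor shift a P₂ k) (shift-⊕ a P₁₆ P₄ k) ⟩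
  (shift a P₁₆ k xor shift a P₄ k) xor shift a P₂ k
    ≡⟨ cong₂ _xor_ (cong₂ _xor_ (shift-shift a (16 * r) (A m) k) (shift-shift a (4 * r) (A (m + 4 * r)) k))
                   (shift-shift a (2 * r) (A (m + 2 * r)) k) ⟩
  (shift (a + 16 * r) (A m) k xor shift (a + 4 * r) (A (m + 4 * r)) k) xor shift (a + 2 * r) (A (m + 2 * r)) k ∎
  where
  open ≡-Reasoning
  P₁₆ = shift (16 * r) (A m)
  P₄ = shift (4 * r) (A (m + 4 * r))
  P₂ = shift (2 * r) (A (m + 2 * r))

-- Expanding each of the three terms once more, the cross terms cancel in pairs over Z/2.
Recurrence-double : ∀ {r A} → Recurrence r A → Recurrence (2 * r) A
Recurrence-double {r} {A} rec n odd-n k = begin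
  A (n + 16 * (2 * r)) k                      ≡⟨ cong (λ i → A i k) (index₃₂ n r) ⟩
  term 0 32                                   ≡⟨ step 0 8 ⟩
  (term 16 16 xor term 4 20) xor term 2 18    ≡⟨ cong₂ _xor_ (cong₂ _xor_ (step 16 0) (step 4 2)) (step 2 1) ⟩
  (((term 32 0 xor term 20 4) xor term 18 2) xor ((term 20 4 xor term 8 8) xor term 6 6))
    xor ((term 18 2 xor term 6 6) xor term 4 4)
                                              ≡⟨ cancel (term 32 0) (term 20 4) (term 18 2) (term 8 8) (term 6 6) (term 4 4) ⟩
  (term 32 0 xor term 8 8) xor term 4 4
    ≡⟨ cong₂ _xor_ (cong₂ _xor_ (term-≡ 32 0 (scale₁₆ r) (+-identityʳ n)) (term-≡ 8 8 (scale₄ r) (index₈ n r)))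
                   (term-≡ 4 4 (scale₂ r) (index₄ n r)) ⟩
  (shift (16 * (2 * r)) (A n) ⊕ shift (4 * (2 * r)) (A (n + 4 * (2 * r))) ⊕ shift (2 * (2 * r)) (A (n + 2 * (2 * r)))) k ∎
  where
  open ≡-Reasoning
  term : ℕ → ℕ → Bool
  term a i = shift (a * r) (A (n + i * r)) k
  term-≡ : ∀ a i {a' n'} → a * r ≡ a' → n + i * r ≡ n' → term a i ≡ shift a' (A n') k
  term-≡ _ _ = cong₂ (λ s i → shift s (A i) k)
  step : ∀ a j → term a (2 * j + 16) ≡ (term (a + 16) (2 * j) xor term (a + 4) (2 * j + 4)) xor term (a + 2) (2 * j + 2)
  step a j = begin
    term a (2 * j + 16)
      ≡⟨ cong (λ i → shift (a * r) (A i) k) (index₁₆ n j r) ⟩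
    shift (a * r) (A (m + 16 * r)) k
      ≡⟨ shift-recurrence {r} {A} rec (a * r) m odd-m k ⟩
    (shift (a * r + 16 * r) (A m) k xor shift (a * r + 4 * r) (A (m + 4 * r)) k) xor shift (a * r + 2 * r) (A (m + 2 * r)) k
      ≡⟨ sym (cong₂ _xor_ (cong₂ _xor_ (term-≡ (a + 16) (2 * j) (*-distribʳ-+ r a 16) refl)
                                       (term-≡ (a + 4) (2 * j + 4) (*-distribʳ-+ r a 4) (shifted 4)))
                          (term-≡ (a + 2) (2 * j + 2) (*-distribʳ-+ r a 2) (shifted 2))) ⟩
    (term (a + 16) (2 * j) xor term (a + 4) (2 * j + 4)) xor term (a + 2) (2 * j + 2) ∎
    where
    m = n + (2 * j) * r
    odd-m : Odd m
    odd-m = subst Odd (cong (n +_) (sym (*-assoc 2 j r))) (odd+even odd-n (j * r))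
    index₁₆ : ∀ n j r → n + (2 * j + 16) * r ≡ n + (2 * j) * r + 16 * r
    index₁₆ = solve-∀
    shifted : ∀ c → n + (2 * j + c) * r ≡ m + c * r
    shifted c = trans (cong (n +_) (*-distribʳ-+ r (2 * j) c)) (sym (+-assoc n _ _))
  cancel : ∀ x y z w v u → (((x xor y) xor z) xor ((y xor w) xor v)) xor ((z xor v) xor u) ≡ (x xor w) xor u
  cancel = solve 6 (λ x y z w v u → (((x :+ y) :+ z) :+ ((y :+ w) :+ v)) :+ ((z :+ v) :+ u) := (x :+ w) :+ u) refl
    where open xor-∧-Solver
  index₃₂ : ∀ n r → n + 16 * (2 * r) ≡ n + 32 * r
  index₃₂ = solve-∀
  scale₁₆ : ∀ r → 32 * r ≡ 16 * (2 * r)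
  scale₁₆ = solve-∀
  scale₄ : ∀ r → 8 * r ≡ 4 * (2 * r)
  scale₄ = solve-∀
  index₈ : ∀ n r → n + 8 * r ≡ n + 4 * (2 * r)
  index₈ = solve-∀
  scale₂ : ∀ r → 4 * r ≡ 2 * (2 * r)
  scale₂ = solve-∀
  index₄ : ∀ n r → n + 4 * r ≡ n + 2 * (2 * r)
  index₄ = solve-∀

Recurrence-2^s* : ∀ {r A} → Recurrence r A → ∀ s → Recurrence (2 ^ s * r) A
Recurrence-2^s* {r} {A} rec zero    = subst (λ R → Recurrence R A) (sym (+-identityʳ r)) rec
Recurrence-2^s* {r} {A} rec (suc s) =
  subst (λ R → Recurrence R A) (sym (*-assoc 2 (2 ^ s) r))
        (Recurrence-double {2 ^ s * r} {A} (Recurrence-2^s* {r} {A} rec s))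

Recurrence-at : ∀ {R A} → Recurrence R A → ∀ e k →
  A (suc (2 * (8 * R + e))) k ≡
    (shift (16 * R) (A (suc (2 * e))) ⊕ shift (4 * R) (A (suc (2 * (e + 2 * R)))) ⊕ shift (2 * R) (A (suc (2 * (e + R))))) k
Recurrence-at {R} {A} rec e k = begin
  A (suc (2 * (8 * R + e))) k
    ≡⟨ cong (λ i → A i k) (index₁₆ e R) ⟩
  A (suc (2 * e) + 16 * R) k
    ≡⟨ rec (suc (2 * e)) (e , refl) k ⟩
  (shift (16 * R) (A (suc (2 * e))) ⊕ shift (4 * R) (A (suc (2 * e) + 4 * R)) ⊕ shift (2 * R) (A (suc (2 * e) + 2 * R))) k
    ≡⟨ cong₂ (λ i j → (shift (16 * R) (A (suc (2 * e))) ⊕ shift (4 * R) (A i) ⊕ shift (2 * R) (A j)) k)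
             (index₄ e R) (index₂ e R) ⟩
  (shift (16 * R) (A (suc (2 * e))) ⊕ shift (4 * R) (A (suc (2 * (e + 2 * R)))) ⊕ shift (2 * R) (A (suc (2 * (e + R))))) k ∎
  where
  open ≡-Reasoning
  index₁₆ : ∀ e R → suc (2 * (8 * R + e)) ≡ suc (2 * e) + 16 * R
  index₁₆ = solve-∀
  index₄ : ∀ e R → suc (2 * e) + 4 * R ≡ suc (2 * (e + 2 * R))
  index₄ = solve-∀
  index₂ : ∀ e R → suc (2 * e) + 2 * R ≡ suc (2 * (e + R))
  index₂ = solve-∀

-- The inductive step

keyBoundedBy-weaken : ∀ {κ κ'} p → κ ≤ₗₑₓ κ' → KeyBoundedBy κ p → KeyBoundedBy κ' p
keyBoundedBy-weaken p κ≤κ' bnd x px = ≤ₗₑₓ-trans (bnd x px) κ≤κ'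

xor-true : ∀ {a b} → a xor b ≡ true → a ≡ true ⊎ b ≡ true
xor-true {true}  _  = inj₁ refl
xor-true {false} b≡ = inj₂ b≡

keyBoundedBy-⊕ : ∀ {κ} p q → KeyBoundedBy κ p → KeyBoundedBy κ q → KeyBoundedBy κ (p ⊕ q)
keyBoundedBy-⊕ p q bnd-p bnd-q x pq with xor-true pq
... | inj₁ px = bnd-p x px
... | inj₂ qx = bnd-q x qx

shift-monomial : ∀ s (p : Poly) x → shift (2 * s) p (suc (2 * x)) ≡ true →
                 ∃[ x' ] (x ≡ x' + s × p (suc (2 * x')) ≡ true)
shift-monomial s p x sp with 2 * s ≤? suc (2 * x)
... | no  2s≰k = contradiction (trans (sym (shift-< p (≰⇒> 2s≰k))) sp) λ ()
... | yes 2s≤k = x ∸ s , sym (m∸n+n≡m s≤x) , trans (cong p (sym k∸2s≡)) (trans (sym (shift-≥ p 2s≤k)) sp)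
  where
  s≤x : s ≤ x
  s≤x = 2*m≤1+2*n⇒m≤n 2s≤k
  k∸2s≡ : suc (2 * x) ∸ 2 * s ≡ suc (2 * (x ∸ s))
  k∸2s≡ = trans (+-∸-assoc 1 (*-monoʳ-≤ 2 s≤x)) (cong suc (sym (*-distribˡ-∸ 2 x s)))

shift-monomial⁻¹ : ∀ s (p : Poly) x → p (suc (2 * x)) ≡ true → shift (2 * s) p (suc (2 * (x + s))) ≡ true
shift-monomial⁻¹ s p x px = trans (shift-≥ p 2s≤k) (trans (cong p k∸2s≡) px)
  where
  k≡ : suc (2 * (x + s)) ≡ suc (2 * x) + 2 * s
  k≡ = cong suc (*-distribˡ-+ 2 x s)
  2s≤k : 2 * s ≤ suc (2 * (x + s))
  2s≤k = subst (2 * s ≤_) (sym k≡) (m≤n+m (2 * s) (suc (2 * x)))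
  k∸2s≡ : suc (2 * (x + s)) ∸ 2 * s ≡ suc (2 * x)
  k∸2s≡ = trans (cong (_∸ 2 * s) k≡) (m+n∸n≡m (suc (2 * x)) (2 * s))

keyBoundedBy-shift : ∀ {κ} p s → KeyBoundedBy κ p → KeyBoundedBy (κ +ₚ key s) (shift (2 * s) p)
keyBoundedBy-shift {κ} p s bnd x sp with shift-monomial s p x sp
... | x' , refl , px' = begin
  key (x' + s) +ₚ (1 , 0)        ≲⟨ +ₚ-monoˡ-≤ₗₑₓ (1 , 0) (key-subadditive x' s) ⟩
  key x' +ₚ key s +ₚ (1 , 0)     ≡⟨ +ₚ-swapʳ (key x') (key s) (1 , 0) ⟩
  key x' +ₚ (1 , 0) +ₚ key s     ≲⟨ +ₚ-monoˡ-≤ₗₑₓ (key s) (bnd x' px') ⟩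
  κ +ₚ key s                     ∎
  where open ≤ₗₑₓ-Reasoning

shift-lead-forced : ∀ m p s x → KeyBounded m p → shift (2 * s) p (suc (2 * x)) ≡ true →
                    key m +ₚ key s ≤ₗₑₓ key x +ₚ (1 , 0) → 1 ≤ aOf m × x ≡ lead m + s
shift-lead-forced m p s x bnd sp m+s≤x with shift-monomial s p x sp
... | x' , refl , px' with key+1≡⇒lead x' m (+ₚ-cancelʳ-≡ _ _ (key s) (≤ₗₑₓ-antisym upper lower))
  where
  upper : key x' +ₚ (1 , 0) +ₚ key s ≤ₗₑₓ key m +ₚ key s
  upper = +ₚ-monoˡ-≤ₗₑₓ (key s) (bnd x' px')
  lower : key m +ₚ key s ≤ₗₑₓ key x' +ₚ (1 , 0) +ₚ key s
  lower = ≤ₗₑₓ-trans m+s≤x (≤ₗₑₓ-trans (+ₚ-monoˡ-≤ₗₑₓ (1 , 0) (key-subadditive x' s))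
                                      (≤ₗₑₓ-reflexive (+ₚ-swapʳ (key x') (key s) (1 , 0))))
... | 1≤a , x'≡ = 1≤a , cong (_+ s) x'≡

xor-true-false-false : ∀ {a b c} → a ≡ true → b ≡ false → c ≡ false → (a xor b) xor c ≡ true
xor-true-false-false refl refl refl = refl

xor-false-true-false : ∀ {a b c} → a ≡ false → b ≡ true → c ≡ false → (a xor b) xor c ≡ true
xor-false-true-false refl refl refl = refl

jump-balance : ∀ l jA jB R e' → (l + 2 * R) + jA ≡ 8 * R + e' → l + jB ≡ e' + 2 * R → jA ≡ jB + 4 * R
jump-balance l jA jB R e' eqA eqB = +-cancelˡ-≡ (l + 2 * R) _ _ (begin
  (l + 2 * R) + jA          ≡⟨ eqA ⟩
  8 * R + e'                ≡⟨ regroup e' R ⟩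
  (e' + 2 * R) + 6 * R      ≡⟨ cong (_+ 6 * R) (sym eqB) ⟩
  (l + jB) + 6 * R          ≡⟨ regroup′ l jB R ⟩
  (l + 2 * R) + (jB + 4 * R) ∎)
  where
  open ≡-Reasoning
  regroup : ∀ e R → 8 * R + e ≡ (e + 2 * R) + 6 * R
  regroup = solve-∀
  regroup′ : ∀ l j R → (l + j) + 6 * R ≡ (l + 2 * R) + (j + 4 * R)
  regroup′ = solve-∀

-- One application of the recurrence at step R, with A_(1 + 2 (8 R + e')) = Q and
-- P₁ = A_(1 + 2 e'), P₂ = A_(1 + 2 (e' + 2 R)), P₃ = A_(1 + 2 (e' + R)).
module Step {R e' : ℕ} {P₁ P₂ P₃ Q : Poly}
  (e'<8R : e' < 8 * R)
  (Q≗ : ∀ k → Q k ≡ (shift (16 * R) P₁ ⊕ shift (4 * R) P₂ ⊕ shift (2 * R) P₃) k)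
  (bnd₁ : KeyBounded e' P₁) (lead₁ : HasLead e' P₁)
  (bnd₂ : KeyBounded (e' + 2 * R) P₂) (lead₂ : HasLead (e' + 2 * R) P₂)
  (bnd₃ : KeyBounded (e' + R) P₃)
  where

  E : ℕ
  E = 8 * R + e'

  private
    16R≡ : 16 * R ≡ 2 * (8 * R)
    16R≡ = regroup R
      where
      regroup : ∀ R → 16 * R ≡ 2 * (8 * R)
      regroup = solve-∀
    4R≡ : 4 * R ≡ 2 * (2 * R)
    4R≡ = regroup R
      where
      regroup : ∀ R → 4 * R ≡ 2 * (2 * R)
      regroup = solve-∀
    key-8R : key (8 * R) ≡ twice (key (2 * R))
    key-8R = trans (cong key (regroup R)) (key-4* (2 * R))
      where
      regroup : ∀ R → 8 * R ≡ 4 * (2 * R)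
      regroup = solve-∀

  S₁ S₂ S₃ : Poly
  S₁ = shift (16 * R) P₁
  S₂ = shift (4 * R) P₂
  S₃ = shift (2 * R) P₃

  module Keys (key-E : key E ≡ key e' +ₚ key (8 * R))
              (R-gap : twice (key R) ≤ₗₑₓ key (8 * R)) (R-gap≢ : twice (key R) ≢ key (8 * R)) where

    bound₁ : KeyBoundedBy (key E) S₁
    bound₁ = subst₂ (λ s κ → KeyBoundedBy κ (shift s P₁)) (sym 16R≡) (sym key-E) (keyBoundedBy-shift P₁ (8 * R) bnd₁)

    key₂-bound : key (e' + 2 * R) +ₚ key (2 * R) ≤ₗₑₓ key E
    key₂-bound = begin
      key (e' + 2 * R) +ₚ key (2 * R)             ≲⟨ +ₚ-monoˡ-≤ₗₑₓ (key (2 * R)) (key-subadditive e' (2 * R)) ⟩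
      key e' +ₚ key (2 * R) +ₚ key (2 * R)        ≡⟨ +ₚ-assoc (key e') (key (2 * R)) (key (2 * R)) ⟩
      key e' +ₚ twice (key (2 * R))               ≡⟨ cong (key e' +ₚ_) (sym key-8R) ⟩
      key e' +ₚ key (8 * R)                       ≡⟨ sym key-E ⟩
      key E                                       ∎
      where open ≤ₗₑₓ-Reasoning

    bound₂ : KeyBoundedBy (key E) S₂
    bound₂ = subst (λ s → KeyBoundedBy (key E) (shift s P₂)) (sym 4R≡)
                   (keyBoundedBy-weaken (shift (2 * (2 * R)) P₂) key₂-bound (keyBoundedBy-shift P₂ (2 * R) bnd₂))

    key₃-bound : key (e' + R) +ₚ key R ≤ₗₑₓ key e' +ₚ twice (key R)
    key₃-bound = ≤ₗₑₓ-trans (+ₚ-monoˡ-≤ₗₑₓ (key R) (key-subadditive e' R))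
                            (≤ₗₑₓ-reflexive (+ₚ-assoc (key e') (key R) (key R)))

    bound₃ : KeyBoundedBy (key E) S₃
    bound₃ = keyBoundedBy-weaken S₃ (≤ₗₑₓ-trans key₃-bound (≤ₗₑₓ-trans (+ₚ-monoʳ-≤ₗₑₓ (key e') R-gap)
                                                                   (≤ₗₑₓ-reflexive (sym key-E))))
                                 (keyBoundedBy-shift P₃ R bnd₃)

    keyBounded : KeyBounded E Q
    keyBounded x qx =
      keyBoundedBy-⊕ (S₁ ⊕ S₂) S₃ (keyBoundedBy-⊕ S₁ S₂ bound₁ bound₂) bound₃ x (trans (sym (Q≗ _)) qx)

    P₃-silent : 1 ≤ aOf E → S₃ (suc (2 * lead E)) ≡ false
    P₃-silent 1≤a =
      ¬-not λ sp → R-gap≢ (+ₚ-cancelˡ-≡ (key e') _ _ (≤ₗₑₓ-antisym (+ₚ-monoʳ-≤ₗₑₓ (key e') R-gap) (upper sp)))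
      where
      upper : S₃ (suc (2 * lead E)) ≡ true → key e' +ₚ key (8 * R) ≤ₗₑₓ key e' +ₚ twice (key R)
      upper sp = begin
        key e' +ₚ key (8 * R)           ≡⟨ sym key-E ⟩
        key E                           ≡⟨ sym (key-lead E 1≤a) ⟩
        key (lead E) +ₚ (1 , 0)         ≲⟨ keyBoundedBy-shift P₃ R bnd₃ (lead E) sp ⟩
        key (e' + R) +ₚ key R           ≲⟨ key₃-bound ⟩
        key e' +ₚ twice (key R)         ∎
        where open ≤ₗₑₓ-Reasoning

    P₁-forced : 1 ≤ aOf E → S₁ (suc (2 * lead E)) ≡ true → 1 ≤ aOf e' × lead E ≡ lead e' + 8 * R
    P₁-forced 1≤a sp =
      shift-lead-forced e' P₁ (8 * R) (lead E) bnd₁ (subst (λ s → shift s P₁ (suc (2 * lead E)) ≡ true) 16R≡ sp)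
                        (≤ₗₑₓ-reflexive (trans (sym key-E) (sym (key-lead E 1≤a))))

    P₂-forced : 1 ≤ aOf E → S₂ (suc (2 * lead E)) ≡ true →
                1 ≤ aOf (e' + 2 * R) × jump (aOf E) ≡ jump (aOf (e' + 2 * R)) + 4 * R
    P₂-forced 1≤a sp
      with shift-lead-forced (e' + 2 * R) P₂ (2 * R) (lead E) bnd₂
                             (subst (λ s → shift s P₂ (suc (2 * lead E)) ≡ true) 4R≡ sp)
                             (≤ₗₑₓ-trans key₂-bound (≤ₗₑₓ-reflexive (sym (key-lead E 1≤a))))
    ... | 1≤a₂ , lead≡ = 1≤a₂ , jump-balance (lead (e' + 2 * R)) (jump (aOf E)) (jump (aOf (e' + 2 * R))) R e'
                                             (trans (cong (_+ jump (aOf E)) (sym lead≡)) (lead+jump E 1≤a))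
                                             (lead+jump (e' + 2 * R) 1≤a₂)

    hasLead-via-P₁ : 1 ≤ aOf e' → lead E ≡ lead e' + 8 * R →
                     (1 ≤ aOf (e' + 2 * R) → jump (aOf E) ≢ jump (aOf (e' + 2 * R)) + 4 * R) → HasLead E Q
    hasLead-via-P₁ 1≤a' lead≡ jumps-differ 1≤a = trans (Q≗ _) (xor-true-false-false P₁-hit P₂-silent (P₃-silent 1≤a))
      where
      P₁-hit : S₁ (suc (2 * lead E)) ≡ true
      P₁-hit = subst₂ (λ s x → shift s P₁ (suc (2 * x)) ≡ true) (sym 16R≡) (sym lead≡)
                      (shift-monomial⁻¹ (8 * R) P₁ (lead e') (lead₁ 1≤a'))
      P₂-silent : S₂ (suc (2 * lead E)) ≡ false
      P₂-silent = ¬-not λ sp → jumps-differ (proj₁ (P₂-forced 1≤a sp)) (proj₂ (P₂-forced 1≤a sp))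

    hasLead-via-P₂ : aOf e' ≡ 0 → 1 ≤ aOf (e' + 2 * R) → lead E ≡ lead (e' + 2 * R) + 2 * R → HasLead E Q
    hasLead-via-P₂ a'≡0 1≤a₂ lead≡ 1≤a = trans (Q≗ _) (xor-false-true-false P₁-silent P₂-hit (P₃-silent 1≤a))
      where
      P₁-silent : S₁ (suc (2 * lead E)) ≡ false
      P₁-silent = ¬-not λ sp → <⇒≢ (proj₁ (P₁-forced 1≤a sp)) (sym a'≡0)
      P₂-hit : S₂ (suc (2 * lead E)) ≡ true
      P₂-hit = subst₂ (λ s x → shift s P₂ (suc (2 * x)) ≡ true) (sym 4R≡) (sym lead≡)
                      (shift-monomial⁻¹ (2 * R) P₂ (lead (e' + 2 * R)) (lead₂ 1≤a₂))

  step-4^i : ∀ i → R ≡ 4 ^ i → KeyBounded E Q × HasLead E Q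
  step-4^i i R≡ = keyBounded , λ 1≤a → hasLead-via-P₁ (subst (1 ≤_) aOf-E 1≤a) lead-E (jumps-differ 1≤a) 1≤a
    where
    8R≡ : 8 * R ≡ 2 * 4 ^ suc i
    8R≡ = trans (cong (8 *_) R≡) (regroup (4 ^ i))
      where
      regroup : ∀ K → 8 * K ≡ 2 * (4 * K)
      regroup = solve-∀
    b'<2^[1+i] : bOf e' < 2 ^ suc i
    b'<2^[1+i] = bOf<2^t (suc i) e' (subst (e' <_) 8R≡ e'<8R)
    E≡ : E ≡ 2 * 4 ^ suc i + e'
    E≡ = cong (_+ e') 8R≡
    aOf-E : aOf E ≡ aOf e'
    aOf-E = trans (cong aOf E≡) (aOf-2*4^j+ (suc i) e' b'<2^[1+i])
    key-E : key E ≡ key e' +ₚ key (8 * R)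
    key-E = trans (cong key E≡) (trans (key-2*4^j+ (suc i) e' b'<2^[1+i]) (cong (λ K → key e' +ₚ key K) (sym 8R≡)))
    lead-E : lead E ≡ lead e' + 8 * R
    lead-E = trans (cong lead E≡) (trans (lead-2*4^j+ (suc i) e' b'<2^[1+i]) (cong (lead e' +_) (sym 8R≡)))
    open Keys key-E (proj₁ (key-gap-4^i i R≡)) (proj₂ (key-gap-4^i i R≡))
    jumps-differ : 1 ≤ aOf E → 1 ≤ aOf (e' + 2 * R) → jump (aOf E) ≢ jump (aOf (e' + 2 * R)) + 4 * R
    jumps-differ 1≤a 1≤a₂ eq = jump≢jump+4^k (suc i) (aOf E) (aOf (e' + 2 * R)) 1≤a 1≤a₂
                                 (trans eq (cong (λ K → jump (aOf (e' + 2 * R)) + 4 * K) R≡))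

  step-2*4^i : ∀ i → R ≡ 2 * 4 ^ i → KeyBounded E Q × HasLead E Q
  step-2*4^i i R≡ = keyBounded , hasLead (aOf e') refl
    where
    8R≡ : 8 * R ≡ 4 ^ suc (suc i)
    8R≡ = trans (cong (8 *_) R≡) (regroup (4 ^ i))
      where
      regroup : ∀ K → 8 * (2 * K) ≡ 4 * (4 * K)
      regroup = solve-∀
    a'<2^[2+i] : aOf e' < 2 ^ suc (suc i)
    a'<2^[2+i] = aOf<2^t (suc (suc i)) e' (subst (e' <_) 8R≡ e'<8R)
    E≡ : E ≡ 4 ^ suc (suc i) + e'
    E≡ = cong (_+ e') 8R≡
    key-E : key E ≡ key e' +ₚ key (8 * R)
    key-E = trans (cong key E≡) (trans (key-4^j+ (suc (suc i)) e' a'<2^[2+i]) (cong (λ K → key e' +ₚ key K) (sym 8R≡)))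
    open Keys key-E (proj₁ (key-gap-2*4^i i R≡)) (proj₂ (key-gap-2*4^i i R≡))
    hasLead : ∀ a → aOf e' ≡ a → HasLead E Q
    hasLead (suc a) a'≡ = hasLead-via-P₁ 1≤a' lead-E jumps-differ
      where
      1≤a' : 1 ≤ aOf e'
      1≤a' = subst (1 ≤_) (sym a'≡) (s≤s z≤n)
      lead-E : lead E ≡ lead e' + 8 * R
      lead-E = trans (cong lead E≡) (trans (lead-4^j+ (suc (suc i)) e' a'<2^[2+i] 1≤a') (cong (lead e' +_) (sym 8R≡)))
      -- g grows too slowly below 2^(2+i) for a jump there to reach 4R.
      jumps-differ : 1 ≤ aOf (e' + 2 * R) → jump (aOf E) ≢ jump (aOf (e' + 2 * R)) + 4 * R
      jumps-differ _ eq = <⇒≱ (16K<3[J+8K]+1 (jump (aOf (e' + 2 * R))) (4 ^ i)) (begin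
        3 * (jump (aOf (e' + 2 * R)) + 8 * 4 ^ i) + 1   ≡⟨ cong (λ z → 3 * z + 1) (sym jump-a'≡) ⟩
        3 * jump (aOf e') + 1                           ≤⟨ +-monoˡ-≤ 1 (*-monoʳ-≤ 3 (jump≤g (aOf e'))) ⟩
        3 * g (aOf e') + 1                              ≤⟨ 3*g+1≤4^t (suc (suc i)) (aOf e') a'<2^[2+i] ⟩
        4 ^ suc (suc i)                                 ≡⟨ regroup (4 ^ i) ⟩
        16 * 4 ^ i                                      ∎)
        where
        open ≤-Reasoning
        jump-a'≡ : jump (aOf e') ≡ jump (aOf (e' + 2 * R)) + 8 * 4 ^ i
        jump-a'≡ = begin-equality
          jump (aOf e')                                ≡⟨ sym (jump-2^j+y (suc (suc i)) (aOf e') 1≤a' a'<2^[2+i]) ⟩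
          jump (2 ^ suc (suc i) + aOf e')              ≡⟨ cong jump (sym (trans (cong aOf E≡) (aOf-4^j+ (suc (suc i)) e' a'<2^[2+i]))) ⟩
          jump (aOf E)                                 ≡⟨ eq ⟩
          jump (aOf (e' + 2 * R)) + 4 * R              ≡⟨ cong (λ K → jump (aOf (e' + 2 * R)) + 4 * K) R≡ ⟩
          jump (aOf (e' + 2 * R)) + 4 * (2 * 4 ^ i)    ≡⟨ cong (jump (aOf (e' + 2 * R)) +_) (sym (*-assoc 4 2 (4 ^ i))) ⟩
          jump (aOf (e' + 2 * R)) + 8 * 4 ^ i          ∎
        regroup : ∀ K → 4 * (4 * K) ≡ 16 * K
        regroup = solve-∀
        16K<3[J+8K]+1 : ∀ J K → 16 * K < 3 * (J + 8 * K) + 1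
        16K<3[J+8K]+1 J K = subst (16 * K <_) (regroup′ J K) (m≤m+n (suc (16 * K)) (3 * J + 8 * K))
          where
          regroup′ : ∀ J K → suc (16 * K) + (3 * J + 8 * K) ≡ 3 * (J + 8 * K) + 1
          regroup′ = solve-∀
    hasLead zero a'≡0 = hasLead-via-P₂ a'≡0 1≤a₂ lead-E
      where
      2R≡ : 2 * R ≡ 4 ^ suc i
      2R≡ = trans (cong (2 *_) R≡) (regroup (4 ^ i))
        where
        regroup : ∀ K → 2 * (2 * K) ≡ 4 * K
        regroup = solve-∀
      m₂≡ : e' + 2 * R ≡ 4 ^ suc i + e'
      m₂≡ = trans (+-comm e' (2 * R)) (cong (_+ e') 2R≡)
      a'<2^[1+i] : aOf e' < 2 ^ suc i
      a'<2^[1+i] = subst (_< 2 ^ suc i) (sym a'≡0) (m^n>0 2 (suc i))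
      1≤a₂ : 1 ≤ aOf (e' + 2 * R)
      1≤a₂ = subst (1 ≤_) (sym (trans (cong aOf m₂≡) (aOf-4^j+ (suc i) e' a'<2^[1+i])))
                   (≤-trans (m^n>0 2 (suc i)) (m≤m+n (2 ^ suc i) (aOf e')))
      lead-E : lead E ≡ lead (e' + 2 * R) + 2 * R
      lead-E = trans (cong lead E≡) (trans (lead-4^[1+j]+ (suc i) e' a'≡0)
                                           (cong₂ (λ m K → lead m + K) (sym m₂≡) (sym 2R≡)))

  step : (∃[ j ] R ≡ 2 ^ j) → KeyBounded E Q × HasLead E Q
  step (j , R≡) with j % 2 | m%n<n j 2 | m≡m%n+n*[m/n] j 2
  ... | zero        | _            | j≡ =
    step-4^i (j / 2) (trans R≡ (trans (cong (2 ^_) j≡) (sym (^-*-assoc 2 2 (j / 2)))))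
  ... | suc zero    | _            | j≡ =
    step-2*4^i (j / 2) (trans R≡ (trans (cong (2 ^_) j≡) (cong (2 *_) (sym (^-*-assoc 2 2 (j / 2))))))
  ... | suc (suc _) | s≤s (s≤s ()) | _

2^j-pos : ∀ {r} → (∃[ j ] r ≡ 2 ^ j) → 1 ≤ r
2^j-pos (j , refl) = m^n>0 2 j

dyadic-window : ∀ q m → 1 ≤ q → q ≤ m → ∃[ s ] (2 ^ s * q ≤ m × m < 2 * (2 ^ s * q))
dyadic-window q m 1≤q q≤m = go (suc m) q 1≤q q≤m (≤-trans (n<1+n m) (m≤n+m (suc m) q))
  where
  go : ∀ f q → 1 ≤ q → q ≤ m → m < q + f → ∃[ s ] (2 ^ s * q ≤ m × m < 2 * (2 ^ s * q))
  go zero    q _   q≤m m<q+0 = contradiction (subst (m <_) (+-identityʳ q) m<q+0) (≤⇒≯ q≤m)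
  go (suc f) q 1≤q q≤m m<q+1+f with m <? 2 * q
  ... | yes m<2q = 0 , subst (_≤ m) (sym (+-identityʳ q)) q≤m , subst (λ z → m < 2 * z) (sym (+-identityʳ q)) m<2q
  ... | no  m≮2q with go f (2 * q) (≤-trans 1≤q (m≤m+n q (q + 0))) (≮⇒≥ m≮2q) m<2q+f
    where
    1+q≤2q : suc q ≤ 2 * q
    1+q≤2q = subst (_≤ 2 * q) (+-comm q 1) (+-monoʳ-≤ q (subst (1 ≤_) (sym (+-identityʳ q)) 1≤q))
    m<2q+f : m < 2 * q + f
    m<2q+f = <-≤-trans m<q+1+f (≤-trans (≤-reflexive (+-suc q f)) (+-monoˡ-≤ f 1+q≤2q))
  ...   | s , lo , hi = suc s , subst (_≤ m) (shuffle (2 ^ s) q) lo , subst (λ z → m < 2 * z) (shuffle (2 ^ s) q) hi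
    where
    shuffle : ∀ P q → P * (2 * q) ≡ 2 * P * q
    shuffle = solve-∀

dyadic-split : ∀ r m → 1 ≤ r → 8 * r ≤ m → ∃[ s ] ∃[ e ] (m ≡ 8 * (2 ^ s * r) + e × e < 8 * (2 ^ s * r))
dyadic-split r m 1≤r 8r≤m with dyadic-window (8 * r) m (≤-trans (s≤s z≤n) (*-monoʳ-≤ 8 1≤r)) 8r≤m
... | s , lo , hi = s , m ∸ 8R , sym (m+[n∸m]≡n 8R≤m) ,
                    +-cancelˡ-< 8R (m ∸ 8R) 8R (subst₂ _<_ (sym (m+[n∸m]≡n 8R≤m)) (regroup′ (2 ^ s) r) hi)
  where
  8R = 8 * (2 ^ s * r)
  regroup : ∀ P r → P * (8 * r) ≡ 8 * (P * r)
  regroup = solve-∀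
  regroup′ : ∀ P r → 2 * (P * (8 * r)) ≡ 8 * (P * r) + 8 * (P * r)
  regroup′ = solve-∀
  8R≤m : 8R ≤ m
  8R≤m = subst (_≤ m) (regroup (2 ^ s) r) lo

module _ {r : ℕ} {A : ℕ → Poly} (r-pow : ∃[ j ] r ≡ 2 ^ j) (oddPoly : ∀ n → Odd n → OddPoly (A n))
         (rec : Recurrence r A) where

  cond1α-step : ∀ s e' → e' < 8 * (2 ^ s * r) →
                (∀ n → n < suc (2 * (8 * (2 ^ s * r) + e')) → Odd n → Cond1α n (A n)) →
                Cond1α (suc (2 * (8 * (2 ^ s * r) + e'))) (A (suc (2 * (8 * (2 ^ s * r) + e'))))
  cond1α-step s e' e'<8R ih =
    keyBounded×hasLead⇒cond1α E (A n) (oddPoly n (E , refl)) (proj₁ bounded×lead) (proj₂ bounded×lead)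
    where
    R = 2 ^ s * r
    E = 8 * R + e'
    n = suc (2 * E)
    P : ℕ → Poly
    P x = A (suc (2 * x))
    below : ∀ x → x < E → Cond1α (suc (2 * x)) (P x)
    below x x<E = ih (suc (2 * x)) (s≤s (*-monoʳ-< 2 x<E)) (x , refl)
    R-pow : ∃[ j ] R ≡ 2 ^ j
    R-pow = s + proj₁ r-pow , trans (cong (2 ^ s *_) (proj₂ r-pow)) (sym (^-distribˡ-+-* 2 s (proj₁ r-pow)))
    e'+c*R<E : ∀ c → c < 8 → e' + c * R < E
    e'+c*R<E c c<8 = subst (e' + c * R <_) (+-comm e' (8 * R))
                           (+-monoʳ-< e' (*-monoˡ-< R {{>-nonZero (2^j-pos R-pow)}} c<8))
    cond₁ : Cond1α (suc (2 * e')) (P e')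
    cond₁ = below e' (subst (λ z → z < E) (+-identityʳ e') (e'+c*R<E 0 (s≤s z≤n)))
    cond₂ : Cond1α (suc (2 * (e' + 2 * R))) (P (e' + 2 * R))
    cond₂ = below (e' + 2 * R) (e'+c*R<E 2 (s≤s (s≤s (s≤s z≤n))))
    cond₃ : Cond1α (suc (2 * (e' + R))) (P (e' + R))
    cond₃ = below (e' + R) (subst (λ z → e' + z < E) (*-identityˡ R) (e'+c*R<E 1 (s≤s (s≤s z≤n))))
    bounded×lead : KeyBounded E (A n) × HasLead E (A n)
    bounded×lead = Step.step {R} {e'} {P e'} {P (e' + 2 * R)} {P (e' + R)} {A n}
      e'<8R (Recurrence-at {R} {A} (Recurrence-2^s* {r} {A} rec s) e')
      (cond1α⇒keyBounded e' (P e') cond₁) (cond1α⇒hasLead e' (P e') cond₁)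
      (cond1α⇒keyBounded (e' + 2 * R) (P (e' + 2 * R)) cond₂)
      (cond1α⇒hasLead (e' + 2 * R) (P (e' + 2 * R)) cond₂)
      (cond1α⇒keyBounded (e' + R) (P (e' + R)) cond₃)
      R-pow

theorem4p1 : (r : ℕ) → (∃[ j ] r ≡ 2 ^ j) →
    (A : ℕ → Poly) →
    (∀ n → Odd n → FiniteSupport (A n) × OddPoly (A n)) →
    (∀ n → Odd n →
    ∀ k → A (n + 16 * r) k ≡ (shift (16 * r) (A n) ⊕ shift (4 * r) (A (n + 4 * r)) ⊕ shift (2 * r) (A (n + 2 * r))) k) →
    (∀ n → Odd n → n < 16 * (r * r) → Cond1α n (A n)) →
    ∀ n → Odd n → Cond1α n (A n)
theorem4p1 r r-pow A shape rec base = <-rec (λ n → Odd n → Cond1α n (A n)) go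
  where
  go : ∀ n → (∀ {n'} → n' < n → Odd n' → Cond1α n' (A n')) → Odd n → Cond1α n (A n)
  go n ih odd-n with n <? 16 * (r * r) | odd-n
  ... | yes n<16r² | _        = base n odd-n n<16r²
  ... | no  n≮16r² | m , refl = from-split (dyadic-split r m (2^j-pos r-pow) 8r≤m)
    where
    16r≤n : 16 * r ≤ suc (2 * m)
    16r≤n = ≤-trans (*-monoʳ-≤ 16 (subst (_≤ r * r) (*-identityʳ r) (*-monoʳ-≤ r (2^j-pos r-pow)))) (≮⇒≥ n≮16r²)
    8r≤m : 8 * r ≤ m
    8r≤m = 2*m≤1+2*n⇒m≤n (subst (_≤ suc (2 * m)) (*-assoc 2 8 r) 16r≤n)
    from-split : ∃[ s ] ∃[ e ] (m ≡ 8 * (2 ^ s * r) + e × e < 8 * (2 ^ s * r)) →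
                 Cond1α (suc (2 * m)) (A (suc (2 * m)))
    from-split (s , e' , m≡ , e'<8R) =
      subst (λ k → Cond1α (suc (2 * k)) (A (suc (2 * k)))) (sym m≡)
            (cond1α-step r-pow (λ n' odd-n' → proj₂ (shape n' odd-n')) rec s e' e'<8R
                         (λ n' n'<n → ih (subst (λ k → n' < suc (2 * k)) (sym m≡) n'<n)))
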